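{- Let $P$ be a finite poset of width two with chain partition as in the context, and let $\Gamma=\mathrm{Reg}(P)$. Let $A,A',B',B\in\Gamma$ be lattice points on one vertical line, with $A$ the highest and $B$ the lowest of them, and let $C,C',D,D'\in\Gamma$ be lattice points on another vertical line, with $C$ the highest and $D$ the lowest of them, such that $\overrightarrow{CC'}=-\overrightarrow{DD'}=\overrightarrow{AA'}=-\overrightarrow{BB'}$ and $\overrightarrow{AB}=\overrightarrow{CD}$. Then $$K_q(A,C)\,K_q(B,D)+K_q(A',C')\,K_q(B',D')\;\geqslant\;K_q(A',C)\,K_q(B',D)+K_q(A,C')\,K_q(B,D'),$$ coefficient-wise as polynomials in $q$.
   Context: $P=(X,\prec)$ is a finite poset of width two with a fixed partition into chains $\mathcal{C}_1=\{\alpha_1\prec\cdots\prec\alpha_{a}\}$ and $\mathcal{C}_2=\{\beta_1\prec\cdots\prec\beta_{b}\}$. The region $\mathrm{Reg}(P)$ is the set of lattice points $(i,j)\in\mathbb{Z}^2$ with $0\le i\le a$, $0\le j\le b$ such that $\{\alpha_1,\dots,\alpha_i\}\cup\{\beta_1,\dots,\beta_j\}$ is a lower set (order ideal) of $P$. A NE lattice path uses unit steps $(1,0)$ (east) and $(0,1)$ (north); it lies in $\mathrm{Reg}(P)$ if all its lattice points do. For lattice points $A,B$, $\mathcal{K}(A,B)$ is the set of NE lattice paths from $A$ to $B$ lying in $\mathrm{Reg}(P)$, and $K_q(A,B):=\sum_{\zeta\in\mathcal{K}(A,B)}q^{\mathrm{wgt}(\zeta)}$, where $\mathrm{wgt}(\zeta)$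 is the sum, over all east steps of $\zeta$, of the sum of the two coordinates of the endpoint of that step (so that for a path from $(0,0)$ to $(a,b)$ encoding a linear extension $L$, with east steps corresponding to elements of $\mathcal{C}_1$, this equals $\sum_i L(\alpha_i)$). $K(A,B):=K_1(A,B)$. Inequality $f\geqslant g$ of polynomials means $f-g$ has nonnegative coefficients. -}

module Defs where

open import Level using (0ℓ)
open import Data.Nat using (ℕ; zero; suc; _+_; _*_; _∸_; _≤_; _<_; _≤?_; _<?_)
open import Data.Fin using (Fin; toℕ)
import Data.Fin as Fin
open import Data.Fin.Properties using (all?)
open import Data.Sum using (_⊎_; inj₁; inj₂)
open import Data.Product using (_×_; _,_; proj₁; proj₂; Σ; ∃)
open import Data.List using (List; []; _∷_; _++_; map; length; filter; upTo)
open import Data.Nat.ListAction using (sum)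
open import Data.List.Relation.Unary.All using (All)
import Data.List.Relation.Unary.All as All
open import Data.Integer using (ℤ; +_; -_) renaming (_-_ to _-ℤ_)
open import Relation.Binary using (Rel; IsStrictPartialOrder; Decidable)
open import Relation.Binary.PropositionalEquality using (_≡_; _≢_)
open import Relation.Nullary using (Dec; yes; no; ¬_)
open import Relation.Nullary.Decidable using (_×-dec_; _→-dec_)
open import Data.Nat using () renaming (_≟_ to _≟ℕ_)

-- Width-two posets with a fixed chain partition C₁ = {α₁ ≺ … ≺ α_a},
-- C₂ = {β₁ ≺ … ≺ β_b}.  The ground set is X = Fin a ⊎ Fin b, where
-- inj₁ k is α_{k+1} and inj₂ k is β_{k+1}.

Elem : ℕ → ℕ → Set
Elem a b = Fin a ⊎ Fin b

record WidthTwoPoset (a b : ℕ) : Set₁ where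
  field
    _≺_      : Rel (Elem a b) 0ℓ
    isSPO    : IsStrictPartialOrder _≡_ _≺_
    _≺?_     : Decidable _≺_
    chain₁   : ∀ (i j : Fin a) → i Fin.< j → inj₁ i ≺ inj₁ j
    chain₂   : ∀ (i j : Fin b) → i Fin.< j → inj₂ i ≺ inj₂ j
    width₂   : Σ (Elem a b) λ x → Σ (Elem a b) λ y →
                 x ≢ y × ¬ (x ≺ y) × ¬ (y ≺ x)

-- Lattice points (points of Reg(P) have nonnegative coordinates)

Point : Set
Point = ℕ × ℕ

xc yc : Point → ℕ
xc = proj₁
yc = proj₂

vec : Point → Point → ℤ × ℤ
vec p q = ((+ xc q) -ℤ (+ xc p)) , ((+ yc q) -ℤ (+ yc p))

negV : ℤ × ℤ → ℤ × ℤ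
negV (u , v) = (- u , - v)

module _ {a b : ℕ} (P : WidthTwoPoset a b) where
  open WidthTwoPoset P

  InIdeal : ℕ → ℕ → Elem a b → Set
  InIdeal i j (inj₁ k) = toℕ k < i
  InIdeal i j (inj₂ k) = toℕ k < j

  IsLowerSet : (Elem a b → Set) → Set
  IsLowerSet S = ∀ x y → y ≺ x → S x → S y

  Reg : Point → Set
  Reg (i , j) = i ≤ a × j ≤ b × IsLowerSet (InIdeal i j)

  private
    inIdeal? : ∀ i j x → Dec (InIdeal i j x)
    inIdeal? i j (inj₁ k) = suc (toℕ k) ≤? i
    inIdeal? i j (inj₂ k) = suc (toℕ k) ≤? j

    allElem? : {Q : Elem a b → Set} → (∀ x → Dec (Q x)) → Dec (∀ x → Q x)
    allElem? {Q} d with all? (λ k → d (inj₁ k)) | all? (λ k → d (inj₂ k))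
    ... | yes p | yes q = yes λ { (inj₁ k) → p k ; (inj₂ k) → q k }
    ... | no ¬p | _     = no λ f → ¬p (λ k → f (inj₁ k))
    ... | _     | no ¬q = no λ f → ¬q (λ k → f (inj₂ k))

  Reg? : ∀ p → Dec (Reg p)
  Reg? (i , j) = (i ≤? a) ×-dec ((j ≤? b) ×-dec
    allElem? (λ x → allElem? (λ y →
      (y ≺? x) →-dec (inIdeal? i j x →-dec inIdeal? i j y))))

  data Step : Set where
    E N : Step

  move : Point → Step → Point
  move (x , y) E = (suc x , y)
  move (x , y) N = (x , suc y)

  pointsOf : Point → List Step → List Point
  pointsOf p []       = p ∷ []
  pointsOf p (s ∷ ζ)  = p ∷ pointsOf (move p s) ζ

  stepSeqs : ℕ → ℕ → List (List Step)
  stepSeqs zero    zero    = [] ∷ []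
  stepSeqs (suc m) zero    = map (E ∷_) (stepSeqs m zero)
  stepSeqs zero    (suc n) = map (N ∷_) (stepSeqs zero n)
  stepSeqs (suc m) (suc n) = map (E ∷_) (stepSeqs m (suc n))
                          ++ map (N ∷_) (stepSeqs (suc m) n)

  nePaths : Point → Point → List (List Step)
  nePaths A B with xc A ≤? xc B | yc A ≤? yc B
  ... | yes _ | yes _ = stepSeqs (xc B ∸ xc A) (yc B ∸ yc A)
  ... | _     | _     = []

  LiesInReg : Point → List Step → Set
  LiesInReg A ζ = All Reg (pointsOf A ζ)

  𝒦 : Point → Point → List (List Step)
  𝒦 A B = filter (λ ζ → All.all? Reg? (pointsOf A ζ)) (nePaths A B)

  wgt : Point → List Step → ℕ
  wgt p []      = 0
  wgt p (E ∷ ζ) = (xc (move p E) + yc (move p E)) + wgt (move p E) ζ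
  wgt p (N ∷ ζ) = wgt (move p N) ζ

-- Polynomials in q with ℕ coefficients, as coefficient functions
-- (f n = coefficient of q^n).

Poly : Set
Poly = ℕ → ℕ

_⊕_ : Poly → Poly → Poly
(f ⊕ g) n = f n + g n

_⊗_ : Poly → Poly → Poly
(f ⊗ g) n = sum (map (λ k → f k * g (n ∸ k)) (upTo (suc n)))

_⩾_ : Poly → Poly → Set
f ⩾ g = ∀ n → g n ≤ f n

infixl 6 _⊕_
infixl 7 _⊗_
infix 4 _⩾_

Kq : {a b : ℕ} → WidthTwoPoset a b → Point → Point → Poly
Kq P A B n = length (filter (λ ζ → wgt P A ζ ≟ℕ n) (𝒦 P A B))

{-# OPTIONS --safe #-}
-- Shift the paths starting at B and B' up by k = yA − yB'.  They then start at A' and A, end at C'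
-- and C, and run in the shifted region Reg(P) + (0, k).  In a pair counted on the right-hand side
-- the path in Reg(P) and the shifted path start and end in crossed order, so they meet, and
-- exchanging their parts before the first meeting, or after the last one, yields a pair counted
-- on the left-hand side, provided the exchanged parts stay in their regions.  As both regions
-- are vertically convex, a point of Reg(P) and a lower point of the shifted region in the same
-- column may always trade places.  Hence for pairs from 𝒦(A,C')𝒦(B,D'), where the shifted path
-- starts below, the exchange before the first meeting always works, while for pairs from
-- 𝒦(A',C)𝒦(B',D), where it ends below, the exchange after the last meeting always works and is
-- used when the other fails.  Exchanges keep the heights of the east steps column by column, so
-- they preserve the total weight, and they are involutions.  Images of the two kinds landing in
-- 𝒦(A',C')𝒦(B',D') do not collide: a pair obtained by the exchange after the last meeting could
-- otherwise be exchanged back before the first meeting, so that exchange would not have failed.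
module Submission where

open import Data.Nat
open import Data.Nat.Properties
open import Data.Nat.ListAction using (sum)
open import Data.Nat.ListAction.Properties using (sum-++)
open import Data.Nat.Tactic.RingSolver using (solve-∀)
open import Algebra.Properties.CommutativeSemigroup +-commutativeSemigroup
  using (xy∙z≈xz∙y) renaming (interchange to +-interchange)
import Data.Integer as ℤ
open import Data.Integer.Properties using (+-injective)
import Data.Integer.Tactic.RingSolver as ℤ-Solver
open import Data.Fin using (Fin; toℕ)
import Data.Fin.Properties as Fin
open import Data.List using (List; []; _∷_; _++_; map; length; filter; upTo; replicate; cartesianProduct)
open import Data.List.Properties
  using ( ∷-injectiveʳ; length-++; map-++; map-cong; upTo-∷ʳ
        ; filter-++; filter-accept; filter-reject; filter-≐; filter-none)
open import Data.List.Membership.Propositional using (_∈_)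
open import Data.List.Membership.Propositional.Properties
open import Data.List.Relation.Unary.Any using (here; there)
open import Data.List.Relation.Unary.All using (All; []; _∷_)
import Data.List.Relation.Unary.All as All
open import Data.List.Relation.Unary.AllPairs using ([]; _∷_)
open import Data.List.Relation.Unary.Linked using (Linked; []; [-]; _∷_)
open import Data.List.Relation.Unary.Unique.Propositional using (Unique)
import Data.List.Relation.Unary.Unique.Propositional.Properties as Unique
open import Data.Product using (∃; _×_; _,_; proj₁; proj₂; curry)
import Data.Product as Product
open import Data.Sum using (_⊎_; inj₁; inj₂; [_,_])
open import Data.Sum.Properties using (inj₁-injective; inj₂-injective)
open import Data.Empty using (⊥; ⊥-elim)
open import Data.Unit using (⊤; tt)
open import Function using (_∘_)
open import Relation.Nullary using (Dec; yes; no; ¬_)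
open import Relation.Nullary.Decidable using (_×-dec_; _⊎-dec_)
open import Relation.Binary using (tri<; tri≈; tri>; IsStrictPartialOrder)
open import Relation.Binary.PropositionalEquality hiding ([_])
open import Defs

-- Counting list elements by weight

private variable
  X Y : Set

countBy : (X → ℕ) → List X → Poly
countBy w xs n = length (filter (λ z → w z ≟ n) xs)

δ : ℕ → ℕ → ℕ
δ c k with c ≟ k
... | yes _ = 1
... | no _  = 0

countBy-∷ : ∀ (w : X → ℕ) x xs n → countBy w (x ∷ xs) n ≡ δ (w x) n + countBy w xs n
countBy-∷ w x xs n with w x ≟ n
... | yes e = cong length (filter-accept (λ z → w z ≟ n) e)
... | no ¬e = cong length (filter-reject (λ z → w z ≟ n) ¬e)

countBy-++ : ∀ (w : X → ℕ) xs ys n → countBy w (xs ++ ys) n ≡ countBy w xs n + countBy w ys n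
countBy-++ w xs ys n = trans (cong length (filter-++ (λ z → w z ≟ n) xs ys)) (length-++ (filter _ xs))

countBy-map : ∀ (w : Y → ℕ) (g : X → Y) xs n → countBy w (map g xs) n ≡ countBy (w ∘ g) xs n
countBy-map w g []       n = refl
countBy-map w g (x ∷ xs) n = begin
  countBy w (map g (x ∷ xs)) n            ≡⟨ countBy-∷ w (g x) (map g xs) n ⟩
  δ (w (g x)) n + countBy w (map g xs) n  ≡⟨ cong (δ (w (g x)) n +_) (countBy-map w g xs n) ⟩
  δ (w (g x)) n + countBy (w ∘ g) xs n    ≡⟨ countBy-∷ (w ∘ g) x xs n ⟨
  countBy (w ∘ g) (x ∷ xs) n              ∎
  where open ≡-Reasoning

δ-refl : ∀ c → δ c c ≡ 1
δ-refl c with c ≟ c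
... | yes _ = refl
... | no c≢c = ⊥-elim (c≢c refl)

δ-≢ : ∀ {c k} → c ≢ k → δ c k ≡ 0
δ-≢ {c} {k} c≢k with c ≟ k
... | yes c≡k = ⊥-elim (c≢k c≡k)
... | no _ = refl

sum-map-+ : ∀ (F H : ℕ → ℕ) l → sum (map (λ k → F k + H k) l) ≡ sum (map F l) + sum (map H l)
sum-map-+ F H []      = refl
sum-map-+ F H (x ∷ l) = trans (cong (F x + H x +_) (sum-map-+ F H l)) (+-interchange (F x) (H x) _ _)

sum-upTo-suc : ∀ (F : ℕ → ℕ) n → sum (map F (upTo (suc n))) ≡ sum (map F (upTo n)) + F n
sum-upTo-suc F n = begin
  sum (map F (upTo (suc n)))            ≡⟨ cong (sum ∘ map F) (upTo-∷ʳ n) ⟨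
  sum (map F (upTo n ++ n ∷ []))        ≡⟨ cong sum (map-++ F (upTo n) (n ∷ [])) ⟩
  sum (map F (upTo n) ++ F n ∷ [])      ≡⟨ sum-++ (map F (upTo n)) (F n ∷ []) ⟩
  sum (map F (upTo n)) + (F n + 0)      ≡⟨ cong (sum (map F (upTo n)) +_) (+-identityʳ (F n)) ⟩
  sum (map F (upTo n)) + F n            ∎
  where open ≡-Reasoning

sum-δ-upTo-≥ : ∀ c (G : ℕ → ℕ) n → n ≤ c → sum (map (λ k → δ c k * G k) (upTo n)) ≡ 0
sum-δ-upTo-≥ c G zero    _   = refl
sum-δ-upTo-≥ c G (suc n) n<c = begin
  sum (map (λ k → δ c k * G k) (upTo (suc n)))  ≡⟨ sum-upTo-suc (λ k → δ c k * G k) n ⟩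
  sum (map (λ k → δ c k * G k) (upTo n)) + δ c n * G n
    ≡⟨ cong₂ _+_ (sum-δ-upTo-≥ c G n (<⇒≤ n<c)) (cong (_* G n) (δ-≢ (>⇒≢ n<c))) ⟩
  0                                             ∎
  where open ≡-Reasoning

sum-δ-upTo-< : ∀ c (G : ℕ → ℕ) n → c < n → sum (map (λ k → δ c k * G k) (upTo n)) ≡ G c
sum-δ-upTo-< c G (suc n) c<1+n
  rewrite sum-upTo-suc (λ k → δ c k * G k) n with m<1+n⇒m<n∨m≡n c<1+n
... | inj₁ c<n  =
  trans (cong₂ _+_ (sum-δ-upTo-< c G n c<n) (cong (_* G n) (δ-≢ (<⇒≢ c<n)))) (+-identityʳ (G c))
... | inj₂ refl =
  trans (cong₂ _+_ (sum-δ-upTo-≥ c G c ≤-refl) (cong (_* G c) (δ-refl c))) (+-identityʳ (G c))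

countBy-+ˡ : ∀ (w : X → ℕ) c xs n → c ≤ n → countBy (λ y → c + w y) xs n ≡ countBy w xs (n ∸ c)
countBy-+ˡ w c xs n c≤n = cong length (filter-≐ _ _ (to , from) xs)
  where
  to : ∀ {y} → c + w y ≡ n → w y ≡ n ∸ c
  to {y} e = trans (sym (m+n∸m≡n c (w y))) (cong (_∸ c) e)
  from : ∀ {y} → w y ≡ n ∸ c → c + w y ≡ n
  from e = trans (cong (c +_) e) (m+[n∸m]≡n c≤n)

countBy-+ˡ-> : ∀ (w : X → ℕ) c xs n → n < c → countBy (λ y → c + w y) xs n ≡ 0
countBy-+ˡ-> w c xs n n<c = cong length (filter-none (λ z → c + w z ≟ n) (All.tabulate {xs = xs} too-heavy))
  where
  too-heavy : ∀ {y} → y ∈ xs → c + w y ≢ n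
  too-heavy {y} _ e = <⇒≱ n<c (subst (c ≤_) e (m≤m+n c (w y)))

countBy-⊗ : ∀ {X Y : Set} (w₁ : X → ℕ) (w₂ : Y → ℕ) xs ys n →
  (countBy w₁ xs ⊗ countBy w₂ ys) n
    ≡ countBy (λ p → w₁ (proj₁ p) + w₂ (proj₂ p)) (cartesianProduct xs ys) n
countBy-⊗ w₁ w₂ [] ys n = sum-map-0 (upTo (suc n))
  where
  sum-map-0 : ∀ (l : List ℕ) → sum (map (λ _ → 0) l) ≡ 0
  sum-map-0 []      = refl
  sum-map-0 (_ ∷ l) = sum-map-0 l
countBy-⊗ {X} {Y} w₁ w₂ (x ∷ xs) ys n = begin
  sum (map (λ k → countBy w₁ (x ∷ xs) k * g (n ∸ k)) (upTo (suc n)))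
    ≡⟨ cong sum (map-cong (λ k → trans (cong (_* g (n ∸ k)) (countBy-∷ w₁ x xs k))
                                        (*-distribʳ-+ (g (n ∸ k)) (δ (w₁ x) k) _)) (upTo (suc n))) ⟩
  sum (map (λ k → δ (w₁ x) k * g (n ∸ k) + countBy w₁ xs k * g (n ∸ k)) (upTo (suc n)))
    ≡⟨ sum-map-+ (λ k → δ (w₁ x) k * g (n ∸ k)) _ (upTo (suc n)) ⟩
  sum (map (λ k → δ (w₁ x) k * g (n ∸ k)) (upTo (suc n))) + (countBy w₁ xs ⊗ g) n
    ≡⟨ cong₂ _+_ head (countBy-⊗ w₁ w₂ xs ys n) ⟩
  countBy w (map (x ,_) ys) n + countBy w (cartesianProduct xs ys) n
    ≡⟨ countBy-++ w (map (x ,_) ys) _ n ⟨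
  countBy w (cartesianProduct (x ∷ xs) ys) n
    ∎
  where
  open ≡-Reasoning
  g = countBy w₂ ys
  w : X × Y → ℕ
  w p = w₁ (proj₁ p) + w₂ (proj₂ p)
  head : sum (map (λ k → δ (w₁ x) k * g (n ∸ k)) (upTo (suc n))) ≡ countBy w (map (x ,_) ys) n
  head with w₁ x ≤? n
  ... | yes w₁x≤n = trans (sum-δ-upTo-< (w₁ x) (λ k → g (n ∸ k)) (suc n) (s≤s w₁x≤n))
                      (sym (trans (countBy-map w (x ,_) ys n) (countBy-+ˡ w₂ (w₁ x) ys n w₁x≤n)))
  ... | no w₁x≰n  = trans (sum-δ-upTo-≥ (w₁ x) _ (suc n) (≰⇒> w₁x≰n))
                      (sym (trans (countBy-map w (x ,_) ys n) (countBy-+ˡ-> w₂ (w₁ x) ys n (≰⇒> w₁x≰n))))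

injective⇒length≤ : ∀ (f : X → Y) xs ys → Unique xs →
  (∀ {x} → x ∈ xs → f x ∈ ys) →
  (∀ {x x'} → x ∈ xs → x' ∈ xs → f x ≡ f x' → x ≡ x') → length xs ≤ length ys
injective⇒length≤ f []       ys _         _   _   = z≤n
injective⇒length≤ f (x ∷ xs) ys (x∉ ∷ u) mem inj with ∈-∃++ (mem (here refl))
... | pre , post , refl = subst (suc (length xs) ≤_) (sym length-split)
  (s≤s (injective⇒length≤ f xs (pre ++ post) u mem' (λ p q → inj (there p) (there q))))
  where
  length-split : length (pre ++ f x ∷ post) ≡ suc (length (pre ++ post))
  length-split = trans (length-++ pre) (trans (+-suc (length pre) (length post)) (cong suc (sym (length-++ pre))))
  mem' : ∀ {z} → z ∈ xs → f z ∈ pre ++ post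
  mem' {z} z∈xs with ∈-++⁻ pre (mem (there z∈xs))
  ... | inj₁ p         = ∈-++⁺ˡ p
  ... | inj₂ (here e)  = ⊥-elim (All.lookup x∉ z∈xs (sym (inj (there z∈xs) (here refl) e)))
  ... | inj₂ (there p) = ∈-++⁺ʳ pre p

countBy-⊎ : ∀ {X Y : Set} (w : X ⊎ Y → ℕ) xs ys n →
  countBy w (map inj₁ xs ++ map inj₂ ys) n ≡ countBy (w ∘ inj₁) xs n + countBy (w ∘ inj₂) ys n
countBy-⊎ w xs ys n = trans (countBy-++ w (map inj₁ xs) (map inj₂ ys) n)
                            (cong₂ _+_ (countBy-map w inj₁ xs n) (countBy-map w inj₂ ys n))

Unique-⊎ : {xs : List X} {ys : List Y} → Unique xs → Unique ys → Unique (map inj₁ xs ++ map inj₂ ys)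
Unique-⊎ {xs = xs} {ys} u v =
  Unique.++⁺ (Unique.map⁺ inj₁-injective u) (Unique.map⁺ inj₂-injective v) disjoint
  where
  disjoint : ∀ {t} → ¬ (t ∈ map inj₁ xs × t ∈ map inj₂ ys)
  disjoint (t∈₁ , t∈₂) with ∈-map⁻ inj₁ t∈₁ | ∈-map⁻ inj₂ t∈₂
  ... | _ , _ , refl | _ , _ , ()

injection⇒countBy≤ : ∀ (f : X → Y) (w : X → ℕ) (v : Y → ℕ) xs ys → Unique xs →
  (∀ {x} → x ∈ xs → f x ∈ ys × v (f x) ≡ w x) →
  (∀ {x x'} → x ∈ xs → x' ∈ xs → f x ≡ f x' → x ≡ x') →
  ∀ n → countBy w xs n ≤ countBy v ys n
injection⇒countBy≤ f w v xs ys uniq image inj n =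
  injective⇒length≤ f (filter wAt xs) (filter vAt ys) (Unique.filter⁺ wAt uniq) image′ inj′
  where
  wAt = λ x → w x ≟ n
  vAt = λ y → v y ≟ n
  image′ : ∀ {x} → x ∈ filter wAt xs → f x ∈ filter vAt ys
  image′ x∈ with ∈-filter⁻ wAt x∈
  ... | x∈xs , wx≡n = ∈-filter⁺ vAt (proj₁ (image x∈xs)) (trans (proj₂ (image x∈xs)) wx≡n)
  inj′ : ∀ {x x'} → x ∈ filter wAt xs → x' ∈ filter wAt xs → f x ≡ f x' → x ≡ x'
  inj′ x∈ x'∈ = inj (proj₁ (∈-filter⁻ wAt x∈)) (proj₁ (∈-filter⁻ wAt x'∈))

-- Meetings and exchanges of height sequences

Overlap : ℕ → ℕ → ℕ → ℕ → Set
Overlap a b a' b' = a ≤ b' × a' ≤ b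

overlap? : ∀ a b a' b' → Dec (Overlap a b a' b')
overlap? a b a' b' = (a ≤? b') ×-dec (a' ≤? b)

Ascending : List ℕ → Set
Ascending = Linked _≤_

lastOr : ℕ → List ℕ → ℕ
lastOr a []      = a
lastOr a (b ∷ r) = lastOr b r

data Meets : ℕ → ℕ → List ℕ → List ℕ → Set where
  here  : ∀ {a a' b b' r r'} → Overlap a b a' b' → Meets a a' (b ∷ r) (b' ∷ r')
  there : ∀ {a a' b b' r r'} → Meets b b' r r' → Meets a a' (b ∷ r) (b' ∷ r')

meets? : ∀ a a' r r' → Dec (Meets a a' r r')
meets? a a' []      _         = no λ ()
meets? a a' (_ ∷ _) []        = no λ ()
meets? a a' (b ∷ r) (b' ∷ r') with overlap? a b a' b' | meets? b b' r r'
... | yes o | _     = yes (here o)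
... | no _  | yes m = yes (there m)
... | no ¬o | no ¬m = no λ { (here o) → ¬o o ; (there m) → ¬m m }

Meets-sym : ∀ {a a' r r'} → Meets a a' r r' → Meets a' a r' r
Meets-sym (here (p , q)) = here (q , p)
Meets-sym (there m)      = there (Meets-sym m)

-- For two paths continuing from heights a and a' with height sequences r and r' of equal
-- length, headSwap exchanges the entries of r and r' in the columns before the first one where
-- the paths meet, and tailSwap those in the columns after the last one.
headSwap : ℕ → ℕ → List ℕ → List ℕ → List ℕ × List ℕ
headSwap a a' (b ∷ r) (b' ∷ r') with overlap? a b a' b'
... | yes _ = (b ∷ r) , (b' ∷ r')
... | no _  = (b' ∷ proj₁ (headSwap b b' r r')) , (b ∷ proj₂ (headSwap b b' r r'))
headSwap a a' r r' = r' , r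

tailSwap : ℕ → ℕ → List ℕ → List ℕ → List ℕ × List ℕ
tailSwap a a' (b ∷ r) (b' ∷ r') with meets? b b' r r'
... | yes _ = (b ∷ proj₁ (tailSwap b b' r r')) , (b' ∷ proj₂ (tailSwap b b' r r'))
... | no _ with overlap? a b a' b'
...   | yes _ = (b' ∷ r') , (b ∷ r)
...   | no _  = (b ∷ r) , (b' ∷ r')
tailSwap a a' r r' = r , r'

module _ {a a' b b' : ℕ} {r r' : List ℕ} where

  headSwap-overlap : Overlap a b a' b' → headSwap a a' (b ∷ r) (b' ∷ r') ≡ ((b ∷ r) , (b' ∷ r'))
  headSwap-overlap o with overlap? a b a' b'
  ... | yes _ = refl
  ... | no ¬o = ⊥-elim (¬o o)

  headSwap-¬overlap : ¬ Overlap a b a' b' →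
    headSwap a a' (b ∷ r) (b' ∷ r')
      ≡ ((b' ∷ proj₁ (headSwap b b' r r')) , (b ∷ proj₂ (headSwap b b' r r')))
  headSwap-¬overlap ¬o with overlap? a b a' b'
  ... | yes o = ⊥-elim (¬o o)
  ... | no _  = refl

  tailSwap-meets : Meets b b' r r' →
    tailSwap a a' (b ∷ r) (b' ∷ r')
      ≡ ((b ∷ proj₁ (tailSwap b b' r r')) , (b' ∷ proj₂ (tailSwap b b' r r')))
  tailSwap-meets m with meets? b b' r r'
  ... | yes _ = refl
  ... | no ¬m = ⊥-elim (¬m m)

  tailSwap-overlap : ¬ Meets b b' r r' → Overlap a b a' b' →
    tailSwap a a' (b ∷ r) (b' ∷ r') ≡ ((b' ∷ r') , (b ∷ r))
  tailSwap-overlap ¬m o with meets? b b' r r'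
  ... | yes m = ⊥-elim (¬m m)
  ... | no _ with overlap? a b a' b'
  ...   | yes _ = refl
  ...   | no ¬o = ⊥-elim (¬o o)

  tailSwap-¬overlap : ¬ Meets b b' r r' → ¬ Overlap a b a' b' →
    tailSwap a a' (b ∷ r) (b' ∷ r') ≡ ((b ∷ r) , (b' ∷ r'))
  tailSwap-¬overlap ¬m ¬o with meets? b b' r r'
  ... | yes m = ⊥-elim (¬m m)
  ... | no _ with overlap? a b a' b'
  ...   | yes o = ⊥-elim (¬o o)
  ...   | no _  = refl

headSwap-involutive : ∀ a a' r r' → Ascending (a ∷ r) → Ascending (a' ∷ r') →
  headSwap a' a (proj₁ (headSwap a a' r r')) (proj₂ (headSwap a a' r r')) ≡ (r , r')
headSwap-involutive a a' (b ∷ r) (b' ∷ r') (a≤b ∷ sr) (a'≤b' ∷ sr') with overlap? a b a' b'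
... | yes _ = headSwap-overlap (a'≤b' , a≤b)
... | no ¬o = trans (headSwap-¬overlap λ { (p , q) → ¬o (q , p) })
                    (cong (λ z → (b ∷ proj₁ z) , (b' ∷ proj₂ z)) (headSwap-involutive b b' r r' sr sr'))
headSwap-involutive a a' []      []      _ _ = refl
headSwap-involutive a a' []      (_ ∷ _) _ _ = refl
headSwap-involutive a a' (_ ∷ _) []      _ _ = refl

tailSwap-preserves-Meets : ∀ a a' r r' → Ascending (a ∷ r) → Ascending (a' ∷ r') → Meets a a' r r' →
  Meets a a' (proj₁ (tailSwap a a' r r')) (proj₂ (tailSwap a a' r r'))
tailSwap-preserves-Meets a a' (b ∷ r) (b' ∷ r') (a≤b ∷ sr) (a'≤b' ∷ sr') m with meets? b b' r r'
... | yes m' = there (tailSwap-preserves-Meets b b' r r' sr sr' m')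
... | no _ with overlap? a b a' b'
...   | yes _ = here (a≤b , a'≤b')
...   | no _  = m

tailSwap-involutive : ∀ a a' r r' → Ascending (a ∷ r) → Ascending (a' ∷ r') →
  tailSwap a a' (proj₁ (tailSwap a a' r r')) (proj₂ (tailSwap a a' r r')) ≡ (r , r')
tailSwap-involutive a a' (b ∷ r) (b' ∷ r') (a≤b ∷ sr) (a'≤b' ∷ sr') with meets? b b' r r'
... | yes m = trans (tailSwap-meets (tailSwap-preserves-Meets b b' r r' sr sr' m))
                    (cong (λ z → (b ∷ proj₁ z) , (b' ∷ proj₂ z)) (tailSwap-involutive b b' r r' sr sr'))
... | no ¬m with overlap? a b a' b'
...   | yes _ = tailSwap-overlap (¬m ∘ Meets-sym) (a≤b , a'≤b')
...   | no ¬o = tailSwap-¬overlap ¬m ¬o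
tailSwap-involutive a a' []      []      _ _ = refl
tailSwap-involutive a a' []      (_ ∷ _) _ _ = refl
tailSwap-involutive a a' (_ ∷ _) []      _ _ = refl

headSwap-lastOr : ∀ a a' r r' → Meets a a' r r' →
  lastOr a' (proj₁ (headSwap a a' r r')) ≡ lastOr a r ×
  lastOr a (proj₂ (headSwap a a' r r')) ≡ lastOr a' r'
headSwap-lastOr a a' (b ∷ r) (b' ∷ r') m with overlap? a b a' b' | m
... | yes _ | _        = refl , refl
... | no ¬o | here o   = ⊥-elim (¬o o)
... | no _  | there m' = headSwap-lastOr b b' r r' m'

tailSwap-lastOr : ∀ a a' r r' → Meets a a' r r' →
  lastOr a (proj₁ (tailSwap a a' r r')) ≡ lastOr a' r' ×
  lastOr a' (proj₂ (tailSwap a a' r r')) ≡ lastOr a r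
tailSwap-lastOr a a' (b ∷ r) (b' ∷ r') m with meets? b b' r r'
... | yes m' = tailSwap-lastOr b b' r r' m'
... | no ¬m with overlap? a b a' b' | m
...   | yes _ | _        = refl , refl
...   | no ¬o | here o   = ⊥-elim (¬o o)
...   | no _  | there m' = ⊥-elim (¬m m')

¬Overlap⇒<ˡ : ∀ {a b a' b'} → a' ≤ b → ¬ Overlap a b a' b' → b' < a
¬Overlap⇒<ˡ a'≤b ¬o = ≰⇒> λ a≤b' → ¬o (a≤b' , a'≤b)

¬Overlap⇒< : ∀ {a b a' b'} → a' ≤ a → a ≤ b → ¬ Overlap a b a' b' → b' < b
¬Overlap⇒< a'≤a a≤b ¬o = <-≤-trans (¬Overlap⇒<ˡ (≤-trans a'≤a a≤b) ¬o) a≤b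

¬Meets⇒lastOr< : ∀ {a a' b b'} r r' → length r ≡ length r' →
  Ascending (a ∷ b ∷ r) → Ascending (a' ∷ b' ∷ r') → a' ≤ a → ¬ Meets a a' (b ∷ r) (b' ∷ r') →
  lastOr b' r' < lastOr b r
¬Meets⇒lastOr< []      []      _   (a≤b ∷ _)  _          a'≤a ¬m = ¬Overlap⇒< a'≤a a≤b (¬m ∘ here)
¬Meets⇒lastOr< (_ ∷ _) (_ ∷ _) len (a≤b ∷ sr) (_ ∷ sr') a'≤a ¬m =
  ¬Meets⇒lastOr< _ _ (suc-injective len) sr sr' (<⇒≤ (¬Overlap⇒< a'≤a a≤b (¬m ∘ here))) (¬m ∘ there)

crossing⇒Meets : ∀ a a' r r' → length r ≡ length r' → 0 < length r →
  Ascending (a ∷ r) → Ascending (a' ∷ r') → a' ≤ a → lastOr a r ≤ lastOr a' r' → Meets a a' r r'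
crossing⇒Meets a a' (b ∷ r) (b' ∷ r') len _ sa sa' a'≤a last≤ with meets? a a' (b ∷ r) (b' ∷ r')
... | yes m = m
... | no ¬m = ⊥-elim (<⇒≱ (¬Meets⇒lastOr< r r' (suc-injective len) sa sa' a'≤a ¬m) last≤)

data Exchanged : List ℕ → List ℕ → List ℕ → List ℕ → Set where
  []   : Exchanged [] [] [] []
  keep : ∀ {b b' r r' s s'} → Exchanged r r' s s' → Exchanged (b ∷ r) (b' ∷ r') (b ∷ s) (b' ∷ s')
  swap : ∀ {b b' r r' s s'} → Exchanged r r' s s' → Exchanged (b ∷ r) (b' ∷ r') (b' ∷ s) (b ∷ s')

Exchanged-refl : ∀ r r' → length r ≡ length r' → Exchanged r r' r r'
Exchanged-refl []      []       _   = []
Exchanged-refl (_ ∷ r) (_ ∷ r') len = keep (Exchanged-refl r r' (suc-injective len))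

Exchanged-flip : ∀ r r' → length r ≡ length r' → Exchanged r r' r' r
Exchanged-flip []      []       _   = []
Exchanged-flip (_ ∷ r) (_ ∷ r') len = swap (Exchanged-flip r r' (suc-injective len))

Exchanged-length : ∀ {r r' s s'} → Exchanged r r' s s' → length s ≡ length r × length s' ≡ length r'
Exchanged-length []       = refl , refl
Exchanged-length (keep e) = Product.map (cong suc) (cong suc) (Exchanged-length e)
Exchanged-length (swap e) = Product.map (cong suc) (cong suc) (Exchanged-length e)

headSwap-Exchanged : ∀ a a' r r' → length r ≡ length r' →
  Exchanged r r' (proj₁ (headSwap a a' r r')) (proj₂ (headSwap a a' r r'))
headSwap-Exchanged a a' []      []       _   = []
headSwap-Exchanged a a' (b ∷ r) (b' ∷ r') len with overlap? a b a' b'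
... | yes _ = Exchanged-refl (b ∷ r) (b' ∷ r') len
... | no _  = swap (headSwap-Exchanged b b' r r' (suc-injective len))

tailSwap-Exchanged : ∀ a a' r r' → length r ≡ length r' →
  Exchanged r r' (proj₁ (tailSwap a a' r r')) (proj₂ (tailSwap a a' r r'))
tailSwap-Exchanged a a' []      []       _   = []
tailSwap-Exchanged a a' (b ∷ r) (b' ∷ r') len with meets? b b' r r'
... | yes _ = keep (tailSwap-Exchanged b b' r r' (suc-injective len))
... | no _ with overlap? a b a' b'
...   | yes _ = swap (Exchanged-flip r r' (suc-injective len))
...   | no _  = Exchanged-refl (b ∷ r) (b' ∷ r') len

heightWeight : ℕ → List ℕ → ℕ
heightWeight x (h ∷ h' ∷ r) = (suc x + h) + heightWeight (suc x) (h' ∷ r)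
heightWeight x _            = 0

private
  +-exchange : ∀ p q {P Q P' Q'} → P + Q ≡ P' + Q' → (p + P) + (q + Q) ≡ (p + P') + (q + Q')
  +-exchange p q {P} {Q} {P'} {Q'} e = begin
    (p + P) + (q + Q)   ≡⟨ +-interchange p P q Q ⟩
    (p + q) + (P + Q)   ≡⟨ cong ((p + q) +_) e ⟩
    (p + q) + (P' + Q') ≡⟨ +-interchange p q P' Q' ⟩
    (p + P') + (q + Q') ∎
    where open ≡-Reasoning

  +-exchange-swap : ∀ p q {P Q P' Q'} → P + Q ≡ P' + Q' → (q + P) + (p + Q) ≡ (p + P') + (q + Q')
  +-exchange-swap p q {P} {Q} {P'} {Q'} e = begin
    (q + P) + (p + Q)   ≡⟨ +-interchange q P p Q ⟩
    (q + p) + (P + Q)   ≡⟨ cong₂ _+_ (+-comm q p) e ⟩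
    (p + q) + (P' + Q') ≡⟨ +-interchange p q P' Q' ⟩
    (p + P') + (q + Q') ∎
    where open ≡-Reasoning

Exchanged-heightWeight : ∀ {x r r' s s'} → Exchanged r r' s s' →
  heightWeight x s + heightWeight x s' ≡ heightWeight x r + heightWeight x r'
Exchanged-heightWeight []        = refl
Exchanged-heightWeight (keep []) = refl
Exchanged-heightWeight (swap []) = refl
Exchanged-heightWeight {x} (keep {b} {b'} e@(keep _)) =
  +-exchange (suc x + b) (suc x + b') (Exchanged-heightWeight e)
Exchanged-heightWeight {x} (keep {b} {b'} e@(swap _)) =
  +-exchange (suc x + b) (suc x + b') (Exchanged-heightWeight e)
Exchanged-heightWeight {x} (swap {b} {b'} e@(keep _)) =
  +-exchange-swap (suc x + b) (suc x + b') (Exchanged-heightWeight e)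
Exchanged-heightWeight {x} (swap {b} {b'} e@(swap _)) =
  +-exchange-swap (suc x + b) (suc x + b') (Exchanged-heightWeight e)

-- Read from column c, a height sequence h₀ ∷ h₁ ∷ … describes a path running from height hᵢ up
-- to hᵢ₊₁ in column c + i; in a vertically convex region the path lies in R iff these ends do.
Admissible : (ℕ → ℕ → Set) → ℕ → List ℕ → Set
Admissible R c (a ∷ b ∷ r) = a ≤ b × R c a × R c b × Admissible R (suc c) (b ∷ r)
Admissible R c _           = ⊤

Admissible⇒Ascending : ∀ {R} c l → Admissible R c l → Ascending l
Admissible⇒Ascending c []          _                 = []
Admissible⇒Ascending c (_ ∷ [])    _                 = [-]
Admissible⇒Ascending c (_ ∷ b ∷ r) (a≤b , _ , _ , ad) = a≤b ∷ Admissible⇒Ascending (suc c) (b ∷ r) ad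

module Swaps (R₁ R₂ : ℕ → ℕ → Set)
             (exchange : ∀ {c u l} → R₁ c u → R₂ c l → l ≤ u → R₁ c l × R₂ c u) where

  HeadSwappable : ℕ → ℕ → ℕ → List ℕ → List ℕ → Set
  HeadSwappable c a a' (b ∷ r) (b' ∷ r') =
    R₁ c a' × R₂ c a × (Overlap a b a' b' ⊎ (R₁ c b' × R₂ c b × HeadSwappable (suc c) b b' r r'))
  HeadSwappable c a a' _ _ = ⊤

  headSwappable? : (∀ c y → Dec (R₁ c y)) → (∀ c y → Dec (R₂ c y)) →
                   ∀ c a a' r r' → Dec (HeadSwappable c a a' r r')
  headSwappable? R₁? R₂? c a a' (b ∷ r) (b' ∷ r') =
    R₁? c a' ×-dec (R₂? c a ×-dec (overlap? a b a' b' ⊎-dec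
      (R₁? c b' ×-dec (R₂? c b ×-dec headSwappable? R₁? R₂? (suc c) b b' r r'))))
  headSwappable? R₁? R₂? c a a' []      _  = yes tt
  headSwappable? R₁? R₂? c a a' (_ ∷ _) [] = yes tt

  headSwap-admissible : ∀ c a a' r r' → Admissible R₁ c (a ∷ r) → Admissible R₂ c (a' ∷ r') →
    length r ≡ length r' → HeadSwappable c a a' r r' →
    Admissible R₁ c (a' ∷ proj₁ (headSwap a a' r r')) × Admissible R₂ c (a ∷ proj₂ (headSwap a a' r r'))
  headSwap-admissible c a a' []      []       _ _ _ _ = tt , tt
  headSwap-admissible c a a' (b ∷ r) (b' ∷ r') (a≤b , _ , R₁b , ad) (a'≤b' , _ , R₂b' , ad') len
                      (R₁a' , R₂a , sw) with overlap? a b a' b' | sw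
  ... | yes (a≤b' , a'≤b) | _ = (a'≤b , R₁a' , R₁b , ad) , (a≤b' , R₂a , R₂b' , ad')
  ... | no ¬o | inj₁ o = ⊥-elim (¬o o)
  ... | no ¬o | inj₂ (R₁b' , R₂b , sw') =
    let ad₁ , ad₂ = headSwap-admissible (suc c) b b' r r' ad ad' (suc-injective len) sw'
    in (a'≤b' , R₁a' , R₁b' , ad₁) , (a≤b , R₂a , R₂b , ad₂)

  headSwap-admissible⁻ : ∀ c a a' r r' →
    Admissible R₁ c (a' ∷ proj₁ (headSwap a a' r r')) →
    Admissible R₂ c (a ∷ proj₂ (headSwap a a' r r')) → HeadSwappable c a a' r r'
  headSwap-admissible⁻ c a a' []      _         _ _ = tt
  headSwap-admissible⁻ c a a' (_ ∷ _) []        _ _ = tt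
  headSwap-admissible⁻ c a a' (b ∷ r) (b' ∷ r') ad ad' with overlap? a b a' b' | ad | ad'
  ... | yes o | _ , R₁a' , _ | _ , R₂a , _ = R₁a' , R₂a , inj₁ o
  ... | no _  | _ , R₁a' , R₁b' , ad₁ | _ , R₂a , R₂b , ad₂ =
    R₁a' , R₂a , inj₂ (R₁b' , R₂b , headSwap-admissible⁻ (suc c) b b' r r' ad₁ ad₂)

  ≤⇒HeadSwappable : ∀ c a a' r r' → Admissible R₁ c (a ∷ r) → Admissible R₂ c (a' ∷ r') →
    a' ≤ a → HeadSwappable c a a' r r'
  ≤⇒HeadSwappable c a a' []      _         _ _ _ = tt
  ≤⇒HeadSwappable c a a' (_ ∷ _) []        _ _ _ = tt
  ≤⇒HeadSwappable c a a' (b ∷ r) (b' ∷ r') (a≤b , R₁a , R₁b , ad) (_ , R₂a' , R₂b' , ad') a'≤a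
    with exchange R₁a R₂a' a'≤a | overlap? a b a' b'
  ... | R₁a' , R₂a | yes o = R₁a' , R₂a , inj₁ o
  ... | R₁a' , R₂a | no ¬o =
    let b'≤b = <⇒≤ (¬Overlap⇒< a'≤a a≤b ¬o)
        R₁b' , R₂b = exchange R₁b R₂b' b'≤b
    in R₁a' , R₂a , inj₂ (R₁b' , R₂b , ≤⇒HeadSwappable (suc c) b b' r r' ad ad' b'≤b)

  HeadSwappable-tailSwap⁻ : ∀ c a a' r r' → Meets a a' r r' →
    HeadSwappable c a a' (proj₁ (tailSwap a a' r r')) (proj₂ (tailSwap a a' r r')) →
    HeadSwappable c a a' r r'
  HeadSwappable-tailSwap⁻ c a a' (b ∷ r) (b' ∷ r') m sw with meets? b b' r r' | sw
  ... | yes _  | R₁a' , R₂a , inj₁ o = R₁a' , R₂a , inj₁ o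
  ... | yes m' | R₁a' , R₂a , inj₂ (R₁b' , R₂b , sw') =
    R₁a' , R₂a , inj₂ (R₁b' , R₂b , HeadSwappable-tailSwap⁻ (suc c) b b' r r' m' sw')
  ... | no ¬m | sw' with overlap? a b a' b' | m | sw'
  ...   | yes o | _        | R₁a' , R₂a , _ = R₁a' , R₂a , inj₁ o
  ...   | no ¬o | here o   | _              = ⊥-elim (¬o o)
  ...   | no _  | there m' | _              = ⊥-elim (¬m m')

  ¬Meets⇒swap-admissible : ∀ c b b' r r' → ¬ Meets b b' r r' → lastOr b' r' ≤ lastOr b r →
    length r ≡ length r' → Admissible R₁ c (b ∷ r) → Admissible R₂ c (b' ∷ r') →
    Admissible R₁ c (b' ∷ r') × Admissible R₂ c (b ∷ r) × b' ≤ b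
  ¬Meets⇒swap-admissible c b b' []      []       _  last≤ _ _ _ = tt , tt , last≤
  ¬Meets⇒swap-admissible c b b' (d ∷ r) (d' ∷ r') ¬m last≤ len
                         (b≤d , R₁b , R₁d , ad) (b'≤d' , R₂b' , R₂d' , ad') =
    let ad₁ , ad₂ , d'≤d =
          ¬Meets⇒swap-admissible (suc c) d d' r r' (¬m ∘ there) last≤ (suc-injective len) ad ad'
        b'≤b = ≤-trans b'≤d' (<⇒≤ (¬Overlap⇒<ˡ (≤-trans b'≤d' d'≤d) (¬m ∘ here)))
        R₁b' , R₂b = exchange R₁b R₂b' b'≤b
        R₁d' , R₂d = exchange R₁d R₂d' d'≤d
    in (b'≤d' , R₁b' , R₁d' , ad₁) , (b≤d , R₂b , R₂d , ad₂) , b'≤b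

  tailSwap-admissible : ∀ c a a' r r' → Meets a a' r r' → lastOr a' r' ≤ lastOr a r →
    length r ≡ length r' → Admissible R₁ c (a ∷ r) → Admissible R₂ c (a' ∷ r') →
    Admissible R₁ c (a ∷ proj₁ (tailSwap a a' r r')) × Admissible R₂ c (a' ∷ proj₂ (tailSwap a a' r r'))
  tailSwap-admissible c a a' (b ∷ r) (b' ∷ r') m last≤ len
                      (a≤b , R₁a , R₁b , ad) (a'≤b' , R₂a' , R₂b' , ad') with meets? b b' r r'
  ... | yes m' =
    let ad₁ , ad₂ = tailSwap-admissible (suc c) b b' r r' m' last≤ (suc-injective len) ad ad'
    in (a≤b , R₁a , R₁b , ad₁) , (a'≤b' , R₂a' , R₂b' , ad₂)
  ... | no ¬m with overlap? a b a' b' | m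
  ...   | yes (a≤b' , a'≤b) | _ =
    let ad₁ , ad₂ , b'≤b =
          ¬Meets⇒swap-admissible (suc c) b b' r r' ¬m last≤ (suc-injective len) ad ad'
        R₁b' , R₂b = exchange R₁b R₂b' b'≤b
    in (a≤b' , R₁a , R₁b' , ad₁) , (a'≤b , R₂a' , R₂b , ad₂)
  ...   | no ¬o | here o   = ⊥-elim (¬o o)
  ...   | no _  | there m' = ⊥-elim (¬m m')

-- Lattice paths as height sequences

VerticallyConvex : (Point → Set) → Set
VerticallyConvex R = ∀ {i j₁ j j₂} → R (i , j₁) → R (i , j₂) → j₁ ≤ j → j ≤ j₂ → R (i , j)

Shifted : ℕ → (Point → Set) → Point → Set
Shifted k R (c , y) = k ≤ y × R (c , y ∸ k)

Shifted-verticallyConvex : ∀ {R} k → VerticallyConvex R → VerticallyConvex (Shifted k R)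
Shifted-verticallyConvex k convex (k≤j₁ , R₁) (_ , R₂) j₁≤j j≤j₂ =
  ≤-trans k≤j₁ j₁≤j , convex R₁ R₂ (∸-monoˡ-≤ k j₁≤j) (∸-monoˡ-≤ k j≤j₂)

Shifted-exchange : ∀ {R} k → VerticallyConvex R → ∀ {c u l} →
  R (c , u) → Shifted k R (c , l) → l ≤ u → R (c , l) × Shifted k R (c , u)
Shifted-exchange k convex {c} {u} {l} R[u] (k≤l , R[l∸k]) l≤u =
  convex R[l∸k] R[u] (m∸n≤m l k) l≤u ,
  ≤-trans k≤l l≤u , convex R[l∸k] R[u] (∸-monoˡ-≤ k l≤u) (m∸n≤m u k)

module _ {a b : ℕ} (P : WidthTwoPoset a b) where
  open WidthTwoPoset P
  open IsStrictPartialOrder isSPO using (irrefl) renaming (trans to ≺-trans)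

  private
    inj₂-≺⇒< : ∀ (k k' : Fin b) → inj₂ k' ≺ inj₂ k → toℕ k' < toℕ k
    inj₂-≺⇒< k k' k'≺k with Fin.<-cmp k' k
    ... | tri< k'<k _ _ = k'<k
    ... | tri≈ _ refl _ = ⊥-elim (irrefl refl k'≺k)
    ... | tri> _ _ k<k' = ⊥-elim (irrefl refl (≺-trans (chain₂ k k' k<k') k'≺k))

  Reg-verticallyConvex : VerticallyConvex (Reg P)
  Reg-verticallyConvex {i} {j₁} {j} {j₂} (i≤a , _ , lower₁) (_ , j₂≤b , lower₂) j₁≤j j≤j₂ =
    i≤a , ≤-trans j≤j₂ j₂≤b , lower
    where
    lower : IsLowerSet P (InIdeal P i j)
    lower (inj₁ k) (inj₁ k') y≺x x∈ = lower₁ (inj₁ k) (inj₁ k') y≺x x∈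
    lower (inj₁ k) (inj₂ k') y≺x x∈ = ≤-trans (lower₁ (inj₁ k) (inj₂ k') y≺x x∈) j₁≤j
    lower (inj₂ k) (inj₁ k') y≺x x∈ = lower₂ (inj₂ k) (inj₁ k') y≺x (≤-trans x∈ j≤j₂)
    lower (inj₂ k) (inj₂ k') y≺x x∈ = <-≤-trans (inj₂-≺⇒< k k' y≺x) (<⇒≤ x∈)

  eastSteps northSteps : List (Step P) → ℕ
  eastSteps []      = 0
  eastSteps (E ∷ ζ) = suc (eastSteps ζ)
  eastSteps (N ∷ ζ) = eastSteps ζ
  northSteps []      = 0
  northSteps (E ∷ ζ) = northSteps ζ
  northSteps (N ∷ ζ) = suc (northSteps ζ)

  heights : ℕ → List (Step P) → List ℕ
  heights y []      = y ∷ []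
  heights y (E ∷ ζ) = y ∷ heights y ζ
  heights y (N ∷ ζ) = heights (suc y) ζ

  norths : ℕ → List (Step P)
  norths n = replicate n N

  eastThenClimb : ℕ → List ℕ → List (Step P)
  eastThenClimb h []       = []
  eastThenClimb h (h' ∷ r) = E ∷ (norths (h' ∸ h) ++ eastThenClimb h' r)

  fromHeights : ℕ → List ℕ → List (Step P)
  fromHeights y []      = []
  fromHeights y (h ∷ r) = norths (h ∸ y) ++ eastThenClimb h r

  heights-norths : ∀ n y ζ → heights y (norths n ++ ζ) ≡ heights (y + n) ζ
  heights-norths zero    y ζ = cong (λ z → heights z ζ) (sym (+-identityʳ y))
  heights-norths (suc n) y ζ =
    trans (heights-norths n (suc y) ζ) (cong (λ z → heights z ζ) (sym (+-suc y n)))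

  heights-climb : ∀ {y h} → y ≤ h → ∀ ζ → heights y (norths (h ∸ y) ++ ζ) ≡ heights h ζ
  heights-climb {y} {h} y≤h ζ =
    trans (heights-norths (h ∸ y) y ζ) (cong (λ z → heights z ζ) (m+[n∸m]≡n y≤h))

  heights-eastThenClimb : ∀ h r → Ascending (h ∷ r) → heights h (eastThenClimb h r) ≡ h ∷ r
  heights-eastThenClimb h []       _            = refl
  heights-eastThenClimb h (h' ∷ r) (h≤h' ∷ asc) =
    cong (h ∷_) (trans (heights-climb h≤h' (eastThenClimb h' r)) (heights-eastThenClimb h' r asc))

  heights-fromHeights : ∀ y h r → Ascending (y ∷ h ∷ r) → heights y (fromHeights y (h ∷ r)) ≡ h ∷ r
  heights-fromHeights y h r (y≤h ∷ asc) =
    trans (heights-climb y≤h (eastThenClimb h r)) (heights-eastThenClimb h r asc)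

  private
    eastThenClimb-heights : ∀ h y ζ → eastThenClimb h (heights y ζ) ≡ E ∷ fromHeights h (heights y ζ)
    eastThenClimb-heights h y []      = refl
    eastThenClimb-heights h y (E ∷ ζ) = refl
    eastThenClimb-heights h y (N ∷ ζ) = eastThenClimb-heights h (suc y) ζ

    N∷norths : ∀ n ζ → N ∷ (norths n ++ ζ) ≡ norths n ++ N ∷ ζ
    N∷norths zero    ζ = refl
    N∷norths (suc n) ζ = cong (N ∷_) (N∷norths n ζ)

    fromHeights-heights≤ : ∀ ζ y h → y ≤ h → fromHeights y (heights h ζ) ≡ norths (h ∸ y) ++ ζ
    fromHeights-heights≤ []      y h _   = refl
    fromHeights-heights≤ (E ∷ ζ) y h _   = cong (norths (h ∸ y) ++_) (trans (eastThenClimb-heights h h ζ)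
      (cong (E ∷_) (trans (fromHeights-heights≤ ζ h h ≤-refl) (cong (λ z → norths z ++ ζ) (n∸n≡0 h)))))
    fromHeights-heights≤ (N ∷ ζ) y h y≤h = trans (fromHeights-heights≤ ζ y (suc h) (m≤n⇒m≤1+n y≤h))
      (trans (cong (λ z → norths z ++ ζ) (+-∸-assoc 1 y≤h)) (N∷norths (h ∸ y) ζ))

  fromHeights-heights : ∀ y ζ → fromHeights y (heights y ζ) ≡ ζ
  fromHeights-heights y ζ =
    trans (fromHeights-heights≤ ζ y y ≤-refl) (cong (λ z → norths z ++ ζ) (n∸n≡0 y))

  length-heights : ∀ y ζ → length (heights y ζ) ≡ suc (eastSteps ζ)
  length-heights y []      = refl
  length-heights y (E ∷ ζ) = cong suc (length-heights y ζ)
  length-heights y (N ∷ ζ) = length-heights (suc y) ζ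

  StartsAtLeast : ℕ → List ℕ → Set
  StartsAtLeast y []      = ⊥
  StartsAtLeast y (h ∷ _) = y ≤ h

  heights-startsAtLeast : ∀ y ζ → StartsAtLeast y (heights y ζ)
  heights-startsAtLeast y []      = ≤-refl
  heights-startsAtLeast y (E ∷ ζ) = ≤-refl
  heights-startsAtLeast y (N ∷ ζ) with heights (suc y) ζ | heights-startsAtLeast (suc y) ζ
  ... | _ ∷ _ | y<h = <⇒≤ y<h

  lastOr-heights : ∀ y ζ → lastOr y (heights y ζ) ≡ y + northSteps ζ
  lastOr-heights y []      = sym (+-identityʳ y)
  lastOr-heights y (E ∷ ζ) = lastOr-heights y ζ
  lastOr-heights y (N ∷ ζ)
    with heights (suc y) ζ | heights-startsAtLeast (suc y) ζ | lastOr-heights (suc y) ζ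
  ... | _ ∷ _ | _ | eq = trans eq (sym (+-suc y (northSteps ζ)))

  wgt≡heightWeight : ∀ x y ζ → wgt P (x , y) ζ ≡ heightWeight x (heights y ζ)
  wgt≡heightWeight x y []      = refl
  wgt≡heightWeight x y (E ∷ ζ)
    with heights y ζ | heights-startsAtLeast y ζ | wgt≡heightWeight (suc x) y ζ
  ... | _ ∷ _ | _ | eq = cong (suc x + y +_) eq
  wgt≡heightWeight x y (N ∷ ζ) = wgt≡heightWeight x (suc y) ζ

  private
    shift-identity : ∀ s y k w e → s + (y + k) + (w + k * e) ≡ s + y + w + k * suc e
    shift-identity = solve-∀

  wgt-shift : ∀ k x y ζ → wgt P (x , y + k) ζ ≡ wgt P (x , y) ζ + k * eastSteps ζ
  wgt-shift k x y []      = sym (*-zeroʳ k)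
  wgt-shift k x y (E ∷ ζ) = begin
    suc x + (y + k) + wgt P (suc x , y + k) ζ
      ≡⟨ cong (suc x + (y + k) +_) (wgt-shift k (suc x) y ζ) ⟩
    suc x + (y + k) + (wgt P (suc x , y) ζ + k * eastSteps ζ)
      ≡⟨ shift-identity (suc x) y k _ (eastSteps ζ) ⟩
    suc x + y + wgt P (suc x , y) ζ + k * suc (eastSteps ζ)
      ∎
    where open ≡-Reasoning
  wgt-shift k x y (N ∷ ζ) = wgt-shift k x (suc y) ζ

  module _ {R : Point → Set} where

    private
      lower : ∀ x y l → R (x , y) → Admissible (curry R) x (suc y ∷ l) → Admissible (curry R) x (y ∷ l)
      lower x y []      _    _                    = tt
      lower x y (_ ∷ _) R[y] (y<h , _ , R[h] , ad) = <⇒≤ y<h , R[y] , R[h] , ad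

    liesIn⇒admissible : ∀ x y ζ → All R (pointsOf P (x , y) ζ) → Admissible (curry R) x (y ∷ heights y ζ)
    liesIn⇒admissible x y []      (R[y] ∷ [])   = ≤-refl , R[y] , R[y] , tt
    liesIn⇒admissible x y (E ∷ ζ) (R[y] ∷ all) = ≤-refl , R[y] , R[y] , liesIn⇒admissible (suc x) y ζ all
    liesIn⇒admissible x y (N ∷ ζ) (R[y] ∷ all) =
      lower x y (heights (suc y) ζ) R[y] (liesIn⇒admissible x (suc y) ζ all)

    admissible⇒liesIn : VerticallyConvex R →
      ∀ x y ζ → Admissible (curry R) x (y ∷ heights y ζ) → All R (pointsOf P (x , y) ζ)
    admissible⇒liesIn convex x y []      (_ , R[y] , _ , _)  = R[y] ∷ []
    admissible⇒liesIn convex x y (E ∷ ζ) (_ , R[y] , _ , ad) = R[y] ∷ admissible⇒liesIn convex (suc x) y ζ ad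
    admissible⇒liesIn convex x y (N ∷ ζ) ad
      with heights (suc y) ζ | heights-startsAtLeast (suc y) ζ | admissible⇒liesIn convex x (suc y) ζ
    ... | _ ∷ _ | y<h | rec with ad
    ...   | _ , R[y] , R[h] , ad' = R[y] ∷ rec (y<h , convex R[y] R[h] (n≤1+n y) y<h , R[h] , ad')

  module _ (k : ℕ) {R : Point → Set} where

    private
      up : ∀ {c y} → R (c , y) → Shifted k R (c , y + k)
      up {c} {y} r = m≤n+m k y , subst (λ z → R (c , z)) (sym (m+n∸n≡m y k)) r

      down : ∀ {c y} → Shifted k R (c , y + k) → R (c , y)
      down {c} {y} (_ , r) = subst (λ z → R (c , z)) (m+n∸n≡m y k) r

    liesIn-shift⁺ : ∀ x y ζ → All R (pointsOf P (x , y) ζ) → All (Shifted k R) (pointsOf P (x , y + k) ζ)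
    liesIn-shift⁺ x y []      (r ∷ [])  = up r ∷ []
    liesIn-shift⁺ x y (E ∷ ζ) (r ∷ all) = up r ∷ liesIn-shift⁺ (suc x) y ζ all
    liesIn-shift⁺ x y (N ∷ ζ) (r ∷ all) = up r ∷ liesIn-shift⁺ x (suc y) ζ all

    liesIn-shift⁻ : ∀ x y ζ → All (Shifted k R) (pointsOf P (x , y + k) ζ) → All R (pointsOf P (x , y) ζ)
    liesIn-shift⁻ x y []      (r ∷ [])  = down r ∷ []
    liesIn-shift⁻ x y (E ∷ ζ) (r ∷ all) = down r ∷ liesIn-shift⁻ (suc x) y ζ all
    liesIn-shift⁻ x y (N ∷ ζ) (r ∷ all) = down r ∷ liesIn-shift⁻ x (suc y) ζ all

  ∈-stepSeqs⁺ : ∀ ζ → ζ ∈ stepSeqs P (eastSteps ζ) (northSteps ζ)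
  ∈-stepSeqs⁺ [] = here refl
  ∈-stepSeqs⁺ (E ∷ ζ) with northSteps ζ | ∈-stepSeqs⁺ ζ
  ... | zero  | ζ∈ = ∈-map⁺ (E ∷_) ζ∈
  ... | suc _ | ζ∈ = ∈-++⁺ˡ (∈-map⁺ (E ∷_) ζ∈)
  ∈-stepSeqs⁺ (N ∷ ζ) with eastSteps ζ | ∈-stepSeqs⁺ ζ
  ... | zero  | ζ∈ = ∈-map⁺ (N ∷_) ζ∈
  ... | suc m | ζ∈ = ∈-++⁺ʳ (map (E ∷_) (stepSeqs P m _)) (∈-map⁺ (N ∷_) ζ∈)

  ∈-stepSeqs⁻ : ∀ m n {ζ} → ζ ∈ stepSeqs P m n → eastSteps ζ ≡ m × northSteps ζ ≡ n
  ∈-stepSeqs⁻ zero    zero    (here refl) = refl , refl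
  ∈-stepSeqs⁻ (suc m) zero    ζ∈ with ∈-map⁻ (E ∷_) ζ∈
  ... | _ , ζ∈′ , refl = Product.map₁ (cong suc) (∈-stepSeqs⁻ m zero ζ∈′)
  ∈-stepSeqs⁻ zero    (suc n) ζ∈ with ∈-map⁻ (N ∷_) ζ∈
  ... | _ , ζ∈′ , refl = Product.map₂ (cong suc) (∈-stepSeqs⁻ zero n ζ∈′)
  ∈-stepSeqs⁻ (suc m) (suc n) ζ∈ with ∈-++⁻ (map (E ∷_) (stepSeqs P m (suc n))) ζ∈
  ... | inj₁ ζ∈E with ∈-map⁻ (E ∷_) ζ∈E
  ...   | _ , ζ∈′ , refl = Product.map₁ (cong suc) (∈-stepSeqs⁻ m (suc n) ζ∈′)
  ∈-stepSeqs⁻ (suc m) (suc n) ζ∈ | inj₂ ζ∈N with ∈-map⁻ (N ∷_) ζ∈N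
  ...   | _ , ζ∈′ , refl = Product.map₂ (cong suc) (∈-stepSeqs⁻ (suc m) n ζ∈′)

  stepSeqs-unique : ∀ m n → Unique (stepSeqs P m n)
  stepSeqs-unique zero    zero    = [] ∷ []
  stepSeqs-unique (suc m) zero    = Unique.map⁺ ∷-injectiveʳ (stepSeqs-unique m zero)
  stepSeqs-unique zero    (suc n) = Unique.map⁺ ∷-injectiveʳ (stepSeqs-unique zero n)
  stepSeqs-unique (suc m) (suc n) =
    Unique.++⁺ (Unique.map⁺ ∷-injectiveʳ (stepSeqs-unique m (suc n)))
               (Unique.map⁺ ∷-injectiveʳ (stepSeqs-unique (suc m) n)) disjoint
    where
    disjoint : ∀ {ζ} → ¬ (ζ ∈ map (E ∷_) (stepSeqs P m (suc n)) ×
                           ζ ∈ map (N ∷_) (stepSeqs P (suc m) n))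
    disjoint (ζ∈E , ζ∈N) with ∈-map⁻ (E ∷_) ζ∈E | ∈-map⁻ (N ∷_) ζ∈N
    ... | _ , _ , refl | _ , _ , ()

  ∈-𝒦⁻ : ∀ {x y x₂ y₂ ζ} → ζ ∈ 𝒦 P (x , y) (x₂ , y₂) →
    x ≤ x₂ × eastSteps ζ ≡ x₂ ∸ x × y + northSteps ζ ≡ y₂ × All (Reg P) (pointsOf P (x , y) ζ)
  ∈-𝒦⁻ {x} {y} {x₂} {y₂} ζ∈
    with ∈-filter⁻ (λ ζ → All.all? (Reg? P) (pointsOf P (x , y) ζ))
                   {xs = nePaths P (x , y) (x₂ , y₂)} ζ∈
  ... | ζ∈ne , inReg with x ≤? x₂ | y ≤? y₂ | ζ∈ne
  ...   | yes x≤x₂ | yes y≤y₂ | ζ∈ss =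
    let e , n = ∈-stepSeqs⁻ _ _ ζ∈ss in x≤x₂ , e , trans (cong (y +_) n) (m+[n∸m]≡n y≤y₂) , inReg
  ...   | no _  | _    | ()
  ...   | yes _ | no _ | ()

  ∈-𝒦⁺ : ∀ {x y x₂ y₂ ζ} → x ≤ x₂ → eastSteps ζ ≡ x₂ ∸ x → y + northSteps ζ ≡ y₂ →
    All (Reg P) (pointsOf P (x , y) ζ) → ζ ∈ 𝒦 P (x , y) (x₂ , y₂)
  ∈-𝒦⁺ {x} {y} {x₂} {y₂} {ζ} x≤x₂ e n inReg =
    ∈-filter⁺ (λ ζ → All.all? (Reg? P) (pointsOf P (x , y) ζ)) ζ∈ne inReg
    where
    ζ∈ne : ζ ∈ nePaths P (x , y) (x₂ , y₂)
    ζ∈ne with x ≤? x₂ | y ≤? y₂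
    ... | yes _ | yes _ =
      subst₂ (λ p q → ζ ∈ stepSeqs P p q) e (trans (sym (m+n∸m≡n y _)) (cong (_∸ y) n))
             (∈-stepSeqs⁺ ζ)
    ... | no x≰x₂ | _      = ⊥-elim (x≰x₂ x≤x₂)
    ... | yes _   | no y≰y₂ = ⊥-elim (y≰y₂ (subst (y ≤_) n (m≤m+n y _)))

  𝒦-unique : ∀ A B → Unique (𝒦 P A B)
  𝒦-unique (x , y) (x₂ , y₂) with x ≤? x₂ | y ≤? y₂
  ... | yes _ | yes _ = Unique.filter⁺ _ (stepSeqs-unique (x₂ ∸ x) (y₂ ∸ y))
  ... | no _  | _     = []
  ... | yes _ | no _  = []

  PathPair : Set
  PathPair = List (Step P) × List (Step P)

  pathPairs : Point → Point → Point → Point → List PathPair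
  pathPairs A C B D = cartesianProduct (𝒦 P A C) (𝒦 P B D)

  pairWeight : Point → Point → PathPair → ℕ
  pairWeight A B (u , ζ) = wgt P A u + wgt P B ζ

  ⊗⊕⊗≗countBy : ∀ A₁ C₁ B₁ D₁ A₂ C₂ B₂ D₂ →
    Kq P A₁ C₁ ⊗ Kq P B₁ D₁ ⊕ Kq P A₂ C₂ ⊗ Kq P B₂ D₂
      ≗ countBy [ pairWeight A₁ B₁ , pairWeight A₂ B₂ ]
                (map inj₁ (pathPairs A₁ C₁ B₁ D₁) ++ map inj₂ (pathPairs A₂ C₂ B₂ D₂))
  ⊗⊕⊗≗countBy A₁ C₁ B₁ D₁ A₂ C₂ B₂ D₂ n = sym (trans
    (countBy-⊎ [ pairWeight A₁ B₁ , pairWeight A₂ B₂ ]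
               (pathPairs A₁ C₁ B₁ D₁) (pathPairs A₂ C₂ B₂ D₂) n)
    (sym (cong₂ _+_ (countBy-⊗ (wgt P A₁) (wgt P B₁) (𝒦 P A₁ C₁) (𝒦 P B₁ D₁) n)
                    (countBy-⊗ (wgt P A₂) (wgt P B₂) (𝒦 P A₂ C₂) (𝒦 P B₂ D₂) n))))

  pathPairs-unique : ∀ A C B D → Unique (pathPairs A C B D)
  pathPairs-unique A C B D = Unique.cartesianProduct⁺ (𝒦-unique A C) (𝒦-unique B D)

-- The weight-preserving injection

module Injection {a b : ℕ} (P : WidthTwoPoset a b)
  (x x₂ yB yB' yD yD' k : ℕ) (yB≤yB' : yB ≤ yB') (yD≤yD' : yD ≤ yD') where

  yA yA' yC yC' m : ℕ
  yA  = yB' + k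
  yA' = yB + k
  yC  = yD' + k
  yC' = yD + k
  m   = x₂ ∸ x

  A A' B B' C C' D D' : Point
  A  = x , yA
  A' = x , yA'
  B  = x , yB
  B' = x , yB'
  C  = x₂ , yC
  C' = x₂ , yC'
  D  = x₂ , yD
  D' = x₂ , yD'

  R₁ R₂ : ℕ → ℕ → Set
  R₁ = curry (Reg P)
  R₂ = curry (Shifted k (Reg P))

  R₂-verticallyConvex : VerticallyConvex (Shifted k (Reg P))
  R₂-verticallyConvex = Shifted-verticallyConvex {Reg P} k (Reg-verticallyConvex P)

  open Swaps R₁ R₂ (Shifted-exchange {Reg P} k (Reg-verticallyConvex P))

  Path : Set
  Path = List (Step P)

  record Encoded (R : ℕ → ℕ → Set) (y₀ : ℕ) (ζ : Path) (y₁ : ℕ) : Set where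
    field
      admissible : Admissible R x (y₀ ∷ heights P y₀ ζ)
      length≡    : length (heights P y₀ ζ) ≡ suc m
      lastOr≡    : lastOr y₀ (heights P y₀ ζ) ≡ y₁
      x≤x₂       : x ≤ x₂

  open Encoded

  encode₁ : ∀ {y₀ y₁ ζ} → ζ ∈ 𝒦 P (x , y₀) (x₂ , y₁) → Encoded R₁ y₀ ζ y₁
  encode₁ {y₀} {y₁} {ζ} ζ∈ with ∈-𝒦⁻ P ζ∈
  ... | x≤x₂ , e , n , inReg = record
    { admissible = liesIn⇒admissible P x y₀ ζ inReg
    ; length≡    = trans (length-heights P y₀ ζ) (cong suc e)
    ; lastOr≡    = trans (lastOr-heights P y₀ ζ) n
    ; x≤x₂       = x≤x₂
    }

  encode₂ : ∀ {z₀ z₁ ζ} → ζ ∈ 𝒦 P (x , z₀) (x₂ , z₁) → Encoded R₂ (z₀ + k) ζ (z₁ + k)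
  encode₂ {z₀} {z₁} {ζ} ζ∈ with ∈-𝒦⁻ P ζ∈
  ... | x≤x₂ , e , n , inReg = record
    { admissible = liesIn⇒admissible P x (z₀ + k) ζ (liesIn-shift⁺ P k x z₀ ζ inReg)
    ; length≡    = trans (length-heights P (z₀ + k) ζ) (cong suc e)
    ; lastOr≡    = trans (lastOr-heights P (z₀ + k) ζ) (trans (xy∙z≈xz∙y z₀ k _) (cong (_+ k) n))
    ; x≤x₂       = x≤x₂
    }

  decode₁ : ∀ {y₀ y₁} r → Admissible R₁ x (y₀ ∷ r) → length r ≡ suc m → lastOr y₀ r ≡ y₁ →
    x ≤ x₂ →
    fromHeights P y₀ r ∈ 𝒦 P (x , y₀) (x₂ , y₁) × heights P y₀ (fromHeights P y₀ r) ≡ r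
  decode₁ {y₀} {y₁} (h ∷ r) ad len last x≤x₂ = ∈-𝒦⁺ P x≤x₂ e n inReg , hs
    where
    ζ  = fromHeights P y₀ (h ∷ r)
    hs = heights-fromHeights P y₀ h r (Admissible⇒Ascending x (y₀ ∷ h ∷ r) ad)
    inReg = admissible⇒liesIn P (Reg-verticallyConvex P) x y₀ ζ
              (subst (λ l → Admissible R₁ x (y₀ ∷ l)) (sym hs) ad)
    e = suc-injective (trans (sym (length-heights P y₀ ζ)) (trans (cong length hs) len))
    n = trans (sym (lastOr-heights P y₀ ζ)) (trans (cong (lastOr y₀) hs) last)

  decode₂ : ∀ {z₀ z₁} r → Admissible R₂ x ((z₀ + k) ∷ r) → length r ≡ suc m →
    lastOr (z₀ + k) r ≡ z₁ + k → x ≤ x₂ →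
    fromHeights P (z₀ + k) r ∈ 𝒦 P (x , z₀) (x₂ , z₁) ×
    heights P (z₀ + k) (fromHeights P (z₀ + k) r) ≡ r
  decode₂ {z₀} {z₁} (h ∷ r) ad len last x≤x₂ = ∈-𝒦⁺ P x≤x₂ e n inReg , hs
    where
    ζ  = fromHeights P (z₀ + k) (h ∷ r)
    hs = heights-fromHeights P (z₀ + k) h r (Admissible⇒Ascending x (z₀ + k ∷ h ∷ r) ad)
    inReg = liesIn-shift⁻ P k x z₀ ζ (admissible⇒liesIn P R₂-verticallyConvex x (z₀ + k) ζ
              (subst (λ l → Admissible R₂ x (z₀ + k ∷ l)) (sym hs) ad))
    e = suc-injective (trans (sym (length-heights P (z₀ + k) ζ)) (trans (cong length hs) len))
    n = +-cancelʳ-≡ k _ _ (trans (xy∙z≈xz∙y z₀ _ k)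
          (trans (sym (lastOr-heights P (z₀ + k) ζ)) (trans (cong (lastOr (z₀ + k)) hs) last)))

  Exchanged-wgt : ∀ {y₀ z₀ y₀' z₀'} u ζ u' ζ' →
    Exchanged (heights P y₀ u) (heights P (z₀ + k) ζ) (heights P y₀' u') (heights P (z₀' + k) ζ') →
    wgt P (x , y₀') u' + wgt P (x , z₀') ζ' ≡ wgt P (x , y₀) u + wgt P (x , z₀) ζ
  Exchanged-wgt {y₀} {z₀} {y₀'} {z₀'} u ζ u' ζ' ex = +-cancelʳ-≡ (k * eastSteps P ζ) _ _ (begin
    wgt P (x , y₀') u' + wgt P (x , z₀') ζ' + k * eastSteps P ζ
      ≡⟨ +-assoc (wgt P (x , y₀') u') _ _ ⟩
    wgt P (x , y₀') u' + (wgt P (x , z₀') ζ' + k * eastSteps P ζ)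
      ≡⟨ cong₂ _+_ (wgt≡heightWeight P x y₀' u')
                   (trans (cong (λ e → wgt P (x , z₀') ζ' + k * e) east≡) (shifted z₀' ζ')) ⟩
    heightWeight x (heights P y₀' u') + heightWeight x (heights P (z₀' + k) ζ')
      ≡⟨ Exchanged-heightWeight ex ⟩
    heightWeight x (heights P y₀ u) + heightWeight x (heights P (z₀ + k) ζ)
      ≡⟨ cong₂ _+_ (wgt≡heightWeight P x y₀ u) (shifted z₀ ζ) ⟨
    wgt P (x , y₀) u + (wgt P (x , z₀) ζ + k * eastSteps P ζ)
      ≡⟨ +-assoc (wgt P (x , y₀) u) _ _ ⟨
    wgt P (x , y₀) u + wgt P (x , z₀) ζ + k * eastSteps P ζ ∎)
    where
    open ≡-Reasoning
    shifted : ∀ z ζ → wgt P (x , z) ζ + k * eastSteps P ζ ≡ heightWeight x (heights P (z + k) ζ)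
    shifted z ζ = trans (sym (wgt-shift P k x z ζ)) (wgt≡heightWeight P x (z + k) ζ)
    east≡ : eastSteps P ζ ≡ eastSteps P ζ'
    east≡ = suc-injective (begin
      suc (eastSteps P ζ)              ≡⟨ length-heights P (z₀ + k) ζ ⟨
      length (heights P (z₀ + k) ζ)    ≡⟨ proj₂ (Exchanged-length ex) ⟨
      length (heights P (z₀' + k) ζ')  ≡⟨ length-heights P (z₀' + k) ζ' ⟩
      suc (eastSteps P ζ')             ∎)

  record Decoded (y₀ y₁ z₀ z₁ : ℕ) (s₁ s₂ : List ℕ) (w : ℕ) : Set where
    field
      ∈pathPairs : (fromHeights P y₀ s₁ , fromHeights P (z₀ + k) s₂)
                     ∈ pathPairs P (x , y₀) (x₂ , y₁) (x , z₀) (x₂ , z₁)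
      heights₁   : heights P y₀ (fromHeights P y₀ s₁) ≡ s₁
      heights₂   : heights P (z₀ + k) (fromHeights P (z₀ + k) s₂) ≡ s₂
      weight     : wgt P (x , y₀) (fromHeights P y₀ s₁) + wgt P (x , z₀) (fromHeights P (z₀ + k) s₂) ≡ w

  decode : ∀ {y₀ y₁ z₀ z₁ y₀' y₁' z₀' z₁' u ζ s₁ s₂} →
    Encoded R₁ y₀ u y₁ → Encoded R₂ (z₀ + k) ζ (z₁ + k) →
    Exchanged (heights P y₀ u) (heights P (z₀ + k) ζ) s₁ s₂ →
    Admissible R₁ x (y₀' ∷ s₁) × Admissible R₂ x (z₀' + k ∷ s₂) →
    lastOr y₀' s₁ ≡ y₁' → lastOr (z₀' + k) s₂ ≡ z₁' + k →
    Decoded y₀' y₁' z₀' z₁' s₁ s₂ (wgt P (x , y₀) u + wgt P (x , z₀) ζ)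
  decode {y₀' = y₀'} {z₀' = z₀'} {u = u} {ζ} {s₁} {s₂} eu eζ ex (ad₁ , ad₂) last₁ last₂ = record
    { ∈pathPairs = ∈-cartesianProduct⁺ (proj₁ d₁) (proj₁ d₂)
    ; heights₁   = proj₂ d₁
    ; heights₂   = proj₂ d₂
    ; weight     = Exchanged-wgt {y₀' = y₀'} {z₀'} u ζ
                     (fromHeights P y₀' s₁) (fromHeights P (z₀' + k) s₂)
                     (subst₂ (Exchanged _ _) (sym (proj₂ d₁)) (sym (proj₂ d₂)) ex)
    }
    where
    d₁ = decode₁ s₁ ad₁ (trans (proj₁ (Exchanged-length ex)) (length≡ eu)) last₁ (x≤x₂ eu)
    d₂ = decode₂ s₂ ad₂ (trans (proj₂ (Exchanged-length ex)) (length≡ eζ)) last₂ (x≤x₂ eu)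

  Tagged : Set
  Tagged = PathPair P ⊎ PathPair P

  headSwapPaths tailSwapPaths : ℕ → ℕ → PathPair P → PathPair P
  headSwapPaths y y' (u , ζ) = fromHeights P y' (proj₁ s) , fromHeights P y (proj₂ s)
    where s = headSwap y y' (heights P y u) (heights P y' ζ)
  tailSwapPaths y y' (u , ζ) = fromHeights P y (proj₁ t) , fromHeights P y' (proj₂ t)
    where t = tailSwap y y' (heights P y u) (heights P y' ζ)

  HeadSwappablePair : PathPair P → Set
  HeadSwappablePair (u , ζ) = HeadSwappable x yA' yA (heights P yA' u) (heights P yA ζ)

  headSwappablePair? : ∀ p → Dec (HeadSwappablePair p)
  headSwappablePair? (u , ζ) =
    headSwappable? (λ c y → Reg? P (c , y)) (λ c y → (k ≤? y) ×-dec Reg? P (c , y ∸ k)) x yA' yA _ _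

  φ₁ : (p : PathPair P) → Dec (HeadSwappablePair p) → Tagged
  φ₁ p (yes _) = inj₁ (headSwapPaths yA' yA p)
  φ₁ p (no _)  = inj₂ (tailSwapPaths yA' yA p)

  φ : Tagged → Tagged
  φ (inj₁ p) = φ₁ p (headSwappablePair? p)
  φ (inj₂ p) = inj₂ (headSwapPaths yA yA' p)

  rhs lhs : List Tagged
  rhs = map inj₁ (pathPairs P A' C B' D) ++ map inj₂ (pathPairs P A C' B D')
  lhs = map inj₁ (pathPairs P A C B D) ++ map inj₂ (pathPairs P A' C' B' D')

  rhsWeight lhsWeight : Tagged → ℕ
  rhsWeight = [ pairWeight P A' B' , pairWeight P A B ]
  lhsWeight = [ pairWeight P A B , pairWeight P A' B' ]

  HeightsOf : ℕ → ℕ → PathPair P → List ℕ × List ℕ → Set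
  HeightsOf y y' (u , ζ) (r , r') = heights P y u ≡ r × heights P y' ζ ≡ r'

  data Preimage (t : Tagged) : Tagged → Set where
    viaHeadSwap₁ : ∀ p → inj₁ (headSwapPaths yA yA' p) ≡ t → Preimage t (inj₁ p)
    viaTailSwap  : ∀ p r r' → ¬ HeadSwappable x yA' yA r r' → Meets yA' yA r r' →
                   HeightsOf yA' yA p (tailSwap yA' yA r r') →
                   inj₁ (tailSwapPaths yA' yA p) ≡ t → Preimage t (inj₂ p)
    viaHeadSwap₂ : ∀ p q q' → Admissible R₁ x (yA ∷ q) → Admissible R₂ x (yA' ∷ q') →
                   HeightsOf yA' yA p (headSwap yA yA' q q') →
                   inj₂ (headSwapPaths yA' yA p) ≡ t → Preimage t (inj₂ p)

  tailSwap-image-¬headSwap-image : ∀ {p r r' q q'} → ¬ HeadSwappable x yA' yA r r' → Meets yA' yA r r' →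
    HeightsOf yA' yA p (tailSwap yA' yA r r') →
    Admissible R₁ x (yA ∷ q) → Admissible R₂ x (yA' ∷ q') →
    HeightsOf yA' yA p (headSwap yA yA' q q') → ⊥
  tailSwap-image-¬headSwap-image {r = r} {r'} {q} {q'} ¬sw meet (t₁≡ , t₂≡) ad ad' (q₁≡ , q₂≡) =
    ¬sw (HeadSwappable-tailSwap⁻ x yA' yA r r' meet
          (headSwap-admissible⁻ x yA' yA t₁ t₂
            (subst (λ s → Admissible R₁ x (yA ∷ proj₁ s)) (sym swapBack) ad)
            (subst (λ s → Admissible R₂ x (yA' ∷ proj₂ s)) (sym swapBack) ad')))
    where
    t₁ = proj₁ (tailSwap yA' yA r r')
    t₂ = proj₂ (tailSwap yA' yA r r')
    swapBack : headSwap yA' yA t₁ t₂ ≡ (q , q')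
    swapBack = trans (cong₂ (headSwap yA' yA) (trans (sym t₁≡) q₁≡) (trans (sym t₂≡) q₂≡))
                     (headSwap-involutive yA yA' q q' (Admissible⇒Ascending x _ ad) (Admissible⇒Ascending x _ ad'))

  Preimage-unique : ∀ {t t' z} → Preimage t z → Preimage t' z → t ≡ t'
  Preimage-unique (viaHeadSwap₁ _ e) (viaHeadSwap₁ _ e') = trans (sym e) e'
  Preimage-unique (viaTailSwap _ _ _ _ _ _ e) (viaTailSwap _ _ _ _ _ _ e') = trans (sym e) e'
  Preimage-unique (viaHeadSwap₂ _ _ _ _ _ _ e) (viaHeadSwap₂ _ _ _ _ _ _ e') = trans (sym e) e'
  Preimage-unique (viaTailSwap p _ _ ¬sw meet t≡ _) (viaHeadSwap₂ _ _ _ ad ad' q≡ _) =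
    ⊥-elim (tailSwap-image-¬headSwap-image {p} ¬sw meet t≡ ad ad' q≡)
  Preimage-unique (viaHeadSwap₂ p _ _ ad ad' q≡ _) (viaTailSwap _ _ _ ¬sw meet t≡ _) =
    ⊥-elim (tailSwap-image-¬headSwap-image {p} ¬sw meet t≡ ad ad' q≡)

  private
    undo : ∀ (σ : List ℕ → List ℕ → List ℕ × List ℕ) {y₁ y₂ z₁ z₂} (p : PathPair P) {u ζ s₁ s₂} →
      heights P y₁ (proj₁ p) ≡ s₁ → heights P y₂ (proj₂ p) ≡ s₂ →
      σ s₁ s₂ ≡ (heights P z₁ u , heights P z₂ ζ) →
      (fromHeights P z₁ (proj₁ (σ (heights P y₁ (proj₁ p)) (heights P y₂ (proj₂ p)))) ,
       fromHeights P z₂ (proj₂ (σ (heights P y₁ (proj₁ p)) (heights P y₂ (proj₂ p))))) ≡ (u , ζ)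
    undo σ {z₁ = z₁} {z₂} _ {u} {ζ} refl refl e =
      trans (cong (λ s → fromHeights P z₁ (proj₁ s) , fromHeights P z₂ (proj₂ s)) e)
            (cong₂ _,_ (fromHeights-heights P z₁ u) (fromHeights-heights P z₂ ζ))

    yA'≤yA : yA' ≤ yA
    yA'≤yA = +-monoˡ-≤ k yB≤yB'

    yC'≤yC : yC' ≤ yC
    yC'≤yC = +-monoˡ-≤ k yD≤yD'

  Encoded-crossing : ∀ {R R' y₀ y₁ z₀ z₁ u ζ} → Encoded R y₀ u y₁ → Encoded R' z₀ ζ z₁ →
    Ascending (y₀ ∷ heights P y₀ u) → Ascending (z₀ ∷ heights P z₀ ζ) →
    z₀ ≤ y₀ → y₁ ≤ z₁ →
    Meets y₀ z₀ (heights P y₀ u) (heights P z₀ ζ)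
  Encoded-crossing eu eζ asc asc' z₀≤y₀ y₁≤z₁ =
    crossing⇒Meets _ _ _ _ (trans (length≡ eu) (sym (length≡ eζ))) (subst (0 <_) (sym (length≡ eu)) z<s)
      asc asc' z₀≤y₀ (subst₂ _≤_ (sym (lastOr≡ eu)) (sym (lastOr≡ eζ)) y₁≤z₁)

  record ValidImage (t z : Tagged) : Set where
    field
      ∈lhs     : z ∈ lhs
      weight≡  : lhsWeight z ≡ rhsWeight t
      preimage : Preimage t z

  module _ {u ζ : Path} (u∈ : u ∈ 𝒦 P A' C) (ζ∈ : ζ ∈ 𝒦 P B' D) where

    private
      eu = encode₁ u∈
      eζ = encode₂ ζ∈
      r  = heights P yA' u
      r' = heights P yA ζ
      asc  = Admissible⇒Ascending x (yA' ∷ r) (admissible eu)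
      asc' = Admissible⇒Ascending x (yA ∷ r') (admissible eζ)
      len : length r ≡ length r'
      len = trans (length≡ eu) (sym (length≡ eζ))
      meet : Meets yA' yA r r'
      meet = Meets-sym (Encoded-crossing eζ eu asc' asc yA'≤yA yC'≤yC)

    φ-headSwap₁ : HeadSwappablePair (u , ζ) →
      ValidImage (inj₁ (u , ζ)) (inj₁ (headSwapPaths yA' yA (u , ζ)))
    φ-headSwap₁ sw = record
      { ∈lhs     = ∈-++⁺ˡ (∈-map⁺ inj₁ (∈pathPairs d))
      ; weight≡  = weight d
      ; preimage = viaHeadSwap₁ _ (cong inj₁ back)
      }
      where
      open Decoded
      s    = headSwap yA' yA r r'
      last = headSwap-lastOr yA' yA r r' meet
      d : Decoded yA yC yB yD (proj₁ s) (proj₂ s) (wgt P A' u + wgt P B' ζ)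
      d = decode eu eζ (headSwap-Exchanged yA' yA r r' len)
            (headSwap-admissible x yA' yA r r' (admissible eu) (admissible eζ) len sw)
            (trans (proj₁ last) (lastOr≡ eu)) (trans (proj₂ last) (lastOr≡ eζ))
      back = undo (headSwap yA yA') (headSwapPaths yA' yA (u , ζ)) (heights₁ d) (heights₂ d)
                  (headSwap-involutive yA' yA r r' asc asc')

    φ-tailSwap : ¬ HeadSwappablePair (u , ζ) →
      ValidImage (inj₁ (u , ζ)) (inj₂ (tailSwapPaths yA' yA (u , ζ)))
    φ-tailSwap ¬sw = record
      { ∈lhs     = ∈-++⁺ʳ (map inj₁ (pathPairs P A C B D)) (∈-map⁺ inj₂ (∈pathPairs d))
      ; weight≡  = weight d
      ; preimage = viaTailSwap _ r r' ¬sw meet (heights₁ d , heights₂ d) (cong inj₁ back)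
      }
      where
      open Decoded
      t    = tailSwap yA' yA r r'
      last = tailSwap-lastOr yA' yA r r' meet
      d : Decoded yA' yC' yB' yD' (proj₁ t) (proj₂ t) (wgt P A' u + wgt P B' ζ)
      d = decode eu eζ (tailSwap-Exchanged yA' yA r r' len)
            (tailSwap-admissible x yA' yA r r' meet (subst₂ _≤_ (sym (lastOr≡ eζ)) (sym (lastOr≡ eu)) yC'≤yC)
              len (admissible eu) (admissible eζ))
            (trans (proj₁ last) (lastOr≡ eζ)) (trans (proj₂ last) (lastOr≡ eu))
      back = undo (tailSwap yA' yA) (tailSwapPaths yA' yA (u , ζ)) (heights₁ d) (heights₂ d)
                  (tailSwap-involutive yA' yA r r' asc asc')

  φ-headSwap₂ : ∀ {u ζ} → u ∈ 𝒦 P A C' → ζ ∈ 𝒦 P B D' →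
    ValidImage (inj₂ (u , ζ)) (inj₂ (headSwapPaths yA yA' (u , ζ)))
  φ-headSwap₂ {u} {ζ} u∈ ζ∈ = record
    { ∈lhs     = ∈-++⁺ʳ (map inj₁ (pathPairs P A C B D)) (∈-map⁺ inj₂ (∈pathPairs d))
    ; weight≡  = weight d
    ; preimage = viaHeadSwap₂ _ r r' (admissible eu) (admissible eζ) (heights₁ d , heights₂ d) (cong inj₂ back)
    }
    where
    open Decoded
    eu = encode₁ u∈
    eζ = encode₂ ζ∈
    r  = heights P yA u
    r' = heights P yA' ζ
    asc  = Admissible⇒Ascending x (yA ∷ r) (admissible eu)
    asc' = Admissible⇒Ascending x (yA' ∷ r') (admissible eζ)
    len  = trans (length≡ eu) (sym (length≡ eζ))
    s    = headSwap yA yA' r r'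
    last = headSwap-lastOr yA yA' r r' (Encoded-crossing eu eζ asc asc' yA'≤yA yC'≤yC)
    d : Decoded yA' yC' yB' yD' (proj₁ s) (proj₂ s) (wgt P A u + wgt P B ζ)
    d = decode eu eζ (headSwap-Exchanged yA yA' r r' len)
          (headSwap-admissible x yA yA' r r' (admissible eu) (admissible eζ) len
            (≤⇒HeadSwappable x yA yA' r r' (admissible eu) (admissible eζ) yA'≤yA))
          (trans (proj₁ last) (lastOr≡ eu)) (trans (proj₂ last) (lastOr≡ eζ))
    back = undo (headSwap yA' yA) (headSwapPaths yA yA' (u , ζ)) (heights₁ d) (heights₂ d)
                (headSwap-involutive yA yA' r r' asc asc')

  φ-valid : ∀ {t} → t ∈ rhs → ValidImage t (φ t)
  φ-valid t∈ with ∈-++⁻ (map inj₁ (pathPairs P A' C B' D)) t∈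
  ... | inj₁ t∈₁ with ∈-map⁻ inj₁ t∈₁
  ...   | (u , ζ) , p∈ , refl
    with ∈-cartesianProduct⁻ (𝒦 P A' C) (𝒦 P B' D) p∈ | headSwappablePair? (u , ζ)
  ...     | u∈ , ζ∈ | yes sw = φ-headSwap₁ u∈ ζ∈ sw
  ...     | u∈ , ζ∈ | no ¬sw = φ-tailSwap u∈ ζ∈ ¬sw
  φ-valid t∈ | inj₂ t∈₂ with ∈-map⁻ inj₂ t∈₂
  ...   | (u , ζ) , p∈ , refl with ∈-cartesianProduct⁻ (𝒦 P A C') (𝒦 P B D') p∈
  ...     | u∈ , ζ∈ = φ-headSwap₂ u∈ ζ∈

  open ValidImage

  shifted-inequality : Kq P A C ⊗ Kq P B D ⊕ Kq P A' C' ⊗ Kq P B' D'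
                         ⩾ Kq P A' C ⊗ Kq P B' D ⊕ Kq P A C' ⊗ Kq P B D'
  shifted-inequality n = subst₂ _≤_ (sym (⊗⊕⊗≗countBy P A' C B' D A C' B D' n))
                                    (sym (⊗⊕⊗≗countBy P A C B D A' C' B' D' n))
    (injection⇒countBy≤ φ rhsWeight lhsWeight rhs lhs
      (Unique-⊎ (pathPairs-unique P A' C B' D) (pathPairs-unique P A C' B D'))
      (λ t∈ → ∈lhs (φ-valid t∈) , weight≡ (φ-valid t∈))
      (λ t∈ t'∈ φt≡φt' → Preimage-unique (preimage (φ-valid t∈))
                           (subst (Preimage _) (sym φt≡φt') (preimage (φ-valid t'∈))))
      n)

-- The vertical shift

private
  diff≡diff⇒+≡+ : ∀ a b c d → ℤ.+ a ℤ.- ℤ.+ b ≡ ℤ.+ c ℤ.- ℤ.+ d → a + d ≡ c + b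
  diff≡diff⇒+≡+ a b c d e = +-injective (begin
    ℤ.+ a ℤ.+ ℤ.+ d                              ≡⟨ left (ℤ.+ a) (ℤ.+ b) (ℤ.+ d) ⟨
    (ℤ.+ a ℤ.- ℤ.+ b) ℤ.+ (ℤ.+ b ℤ.+ ℤ.+ d)      ≡⟨ cong (ℤ._+ (ℤ.+ b ℤ.+ ℤ.+ d)) e ⟩
    (ℤ.+ c ℤ.- ℤ.+ d) ℤ.+ (ℤ.+ b ℤ.+ ℤ.+ d)      ≡⟨ right (ℤ.+ c) (ℤ.+ b) (ℤ.+ d) ⟩
    ℤ.+ c ℤ.+ ℤ.+ b                              ∎)
    where
    open ≡-Reasoning
    left : ∀ x y w → (x ℤ.- y) ℤ.+ (y ℤ.+ w) ≡ x ℤ.+ w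
    left = ℤ-Solver.solve-∀
    right : ∀ z y w → (z ℤ.- w) ℤ.+ (y ℤ.+ w) ≡ z ℤ.+ y
    right = ℤ-Solver.solve-∀

  diff≡-diff⇒+≡+ : ∀ a b c d → ℤ.+ a ℤ.- ℤ.+ b ≡ ℤ.- (ℤ.+ c ℤ.- ℤ.+ d) → a + c ≡ d + b
  diff≡-diff⇒+≡+ a b c d e = diff≡diff⇒+≡+ a b d c (trans e (neg-diff (ℤ.+ c) (ℤ.+ d)))
    where
    neg-diff : ∀ x y → ℤ.- (x ℤ.- y) ≡ y ℤ.- x
    neg-diff = ℤ-Solver.solve-∀

vertical-shift : ∀ {yA yA' yB yB' yC yC' yD yD'} → yB' ≤ yA →
  yC' + yA ≡ yA' + yC → yC' + yD' ≡ yD + yC → yC' + yB' ≡ yB + yC → yB + yC ≡ yD + yA →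
  ∃ λ k → yB' + k ≡ yA × yB + k ≡ yA' × yD' + k ≡ yC × yD + k ≡ yC'
vertical-shift {yA} {yA'} {yB} {yB'} {yC} {yC'} {yD} {yD'} yB'≤yA CC'≡AA' CC'≡-DD' CC'≡-BB' AB≡CD =
  k , A , A' , C , C'
  where
  open ≡-Reasoning
  k = yA ∸ yB'
  A : yB' + k ≡ yA
  A = m+[n∸m]≡n yB'≤yA
  A' : yB + k ≡ yA'
  A' = +-cancelʳ-≡ yC _ _ (begin
    yB + k + yC           ≡⟨ xy∙z≈xz∙y yB k yC ⟩
    yB + yC + k           ≡⟨ cong (_+ k) CC'≡-BB' ⟨
    yC' + yB' + k         ≡⟨ +-assoc yC' yB' k ⟩
    yC' + (yB' + k)       ≡⟨ cong (yC' +_) A ⟩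
    yC' + yA              ≡⟨ CC'≡AA' ⟩
    yA' + yC              ∎)
  C' : yD + k ≡ yC'
  C' = +-cancelʳ-≡ yB' _ _ (begin
    yD + k + yB'          ≡⟨ +-assoc yD k yB' ⟩
    yD + (k + yB')        ≡⟨ cong (yD +_) (trans (+-comm k yB') A) ⟩
    yD + yA               ≡⟨ AB≡CD ⟨
    yB + yC               ≡⟨ CC'≡-BB' ⟨
    yC' + yB'             ∎)
  C : yD' + k ≡ yC
  C = +-cancelʳ-≡ yC' _ _ (begin
    yD' + k + yC'         ≡⟨ xy∙z≈xz∙y yD' k yC' ⟩
    yD' + yC' + k         ≡⟨ cong (_+ k) (+-comm yD' yC') ⟩
    yC' + yD' + k         ≡⟨ cong (_+ k) CC'≡-DD' ⟩
    yD + yC + k           ≡⟨ xy∙z≈xz∙y yD yC k ⟩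
    yD + k + yC           ≡⟨ cong (_+ yC) C' ⟩
    yC' + yC              ≡⟨ +-comm yC' yC ⟩
    yC + yC'              ∎)

lemma3p1 : ∀ {a b : ℕ} (P : WidthTwoPoset a b)
    (A A' B' B C C' D D' : Point) →
    Reg P A → Reg P A' → Reg P B' → Reg P B →
    Reg P C → Reg P C' → Reg P D → Reg P D' →
    -- A, A', B', B on one vertical line, A highest, B lowest
    xc A' ≡ xc A → xc B' ≡ xc A → xc B ≡ xc A →
    yc A' ≤ yc A → yc B' ≤ yc A → yc B ≤ yc A →
    yc B ≤ yc A' → yc B ≤ yc B' →
    -- C, C', D, D' on another vertical line, C highest, D lowest
    xc C' ≡ xc C → xc D' ≡ xc C → xc D ≡ xc C →
    xc C ≢ xc A →
    yc C' ≤ yc C → yc D' ≤ yc C → yc D ≤ yc C →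
    yc D ≤ yc C' → yc D ≤ yc D' →
    -- CC' = -DD' = AA' = -BB' and AB = CD
    vec C C' ≡ vec A A' →
    vec C C' ≡ negV (vec D D') →
    vec C C' ≡ negV (vec B B') →
    vec A B ≡ vec C D →
    Kq P A C ⊗ Kq P B D ⊕ Kq P A' C' ⊗ Kq P B' D'
      ⩾ Kq P A' C ⊗ Kq P B' D ⊕ Kq P A C' ⊗ Kq P B D'
lemma3p1 P (x , yA) (_ , yA') (_ , yB') (_ , yB) (x₂ , yC) (_ , yC') (_ , yD) (_ , yD')
  _ _ _ _ _ _ _ _ refl refl refl _ yB'≤yA _ _ yB≤yB' refl refl refl _ _ _ _ _ yD≤yD'
  CC'≡AA' CC'≡-DD' CC'≡-BB' AB≡CD
  -- Besides the coordinate equations only yB' ≤ yA, yB ≤ yB' and yD ≤ yD' are used: paths in 𝒦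
  -- lie in Reg(P) by definition, and if xc C < xc A all the 𝒦 here are empty.
  with vertical-shift {yA} {yA'} {yB} {yB'} {yC} {yC'} {yD} {yD'} yB'≤yA
         (diff≡diff⇒+≡+  yC' yC yA' yA (cong proj₂ CC'≡AA'))
         (diff≡-diff⇒+≡+ yC' yC yD' yD (cong proj₂ CC'≡-DD'))
         (diff≡-diff⇒+≡+ yC' yC yB' yB (cong proj₂ CC'≡-BB'))
         (diff≡diff⇒+≡+  yB yA yD yC (cong proj₂ AB≡CD))
... | k , refl , refl , refl , refl = Injection.shifted-inequality P x x₂ yB yB' yD yD' k yB≤yB' yD≤yD'
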